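{- Let $k$, $m$ and $n$ be positive integers and let $x_1,\ldots,x_n$ be independent variables. Let $f$ denote either the elementary symmetric functions $e$ or the complete homogeneous symmetric functions $h$. Then $$f_k(\underbrace{x_1,\ldots,x_n,\ldots,x_1,\ldots,x_n}_{m\text{ copies}})=\sum_{\substack{\lambda\vdash k\\ l(\lambda)\le m}}\binom{m}{m-l(\lambda),\lambda}f_\lambda(x_1,\ldots,x_n),$$ where the left side is $f_k$ evaluated at the $mn$ variables consisting of $m$ consecutive copies of the list $x_1,\ldots,x_n$, and $$\binom{m}{m-l(\lambda),\lambda}=\frac{m!}{(m-l(\lambda))!\,t_1(\lambda)!\cdots t_k(\lambda)!}.$$
   Context: For variables $y_1,\ldots,y_N$ and $j\ge1$: $e_j(y_1,\ldots,y_N)=\sum_{1\le i_1<\cdots<i_j\le N}y_{i_1}\cdots y_{i_j}$ (zero if $j>N$), $h_j(y_1,\ldots,y_N)=\sum_{1\le i_1\le\cdots\le i_j\le N}y_{i_1}\cdots y_{i_j}$; $e_0=h_0=1$. A partition $\lambda\vdash k$ is a nonincreasing sequence of positive integers summing to $k$; $l(\lambda)$ is its number of parts and $t_i(\lambda)$ the number of parts equal to $i$. For a partition $\lambda$, $f_\lambda=\prod_{i\ge1}f_i^{t_i(\lambda)}$. -}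

module Defs where

open import Level using (Level)
open import Data.Bool using (Bool; true; false; _∧_)
open import Data.Nat as ℕ using (ℕ; zero; suc; _∸_; _!; _≡ᵇ_; _≤ᵇ_; _<ᵇ_; NonZero)
open import Data.Nat.Properties using (_!≢0; m*n≢0)
open import Data.Nat.DivMod using (_/_)
open import Data.Fin using (Fin; toℕ)
open import Data.List using (List; []; _∷_; [_]; map; concatMap; concat; replicate;
  tabulate; allFin; upTo; length; filterᵇ; lookup; foldr)
open import Algebra.Bundles using (CommutativeRing; Semiring)
import Algebra.Definitions.RawSemiring as RS

tuples : ∀ {a} {A : Set a} → List A → ℕ → List (List A)
tuples as zero    = [ [] ]
tuples as (suc j) = concatMap (λ a → map (a ∷_) (tuples as j)) as

strictlyIncreasing : ∀ {N} → List (Fin N) → Bool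
strictlyIncreasing []           = true
strictlyIncreasing (i ∷ [])     = true
strictlyIncreasing (i ∷ j ∷ is) = (toℕ i <ᵇ toℕ j) ∧ strictlyIncreasing (j ∷ is)

weaklyIncreasing : ∀ {N} → List (Fin N) → Bool
weaklyIncreasing []           = true
weaklyIncreasing (i ∷ [])     = true
weaklyIncreasing (i ∷ j ∷ is) = (toℕ i ≤ᵇ toℕ j) ∧ weaklyIncreasing (j ∷ is)

nonincreasing : List ℕ → Bool
nonincreasing []           = true
nonincreasing (a ∷ [])     = true
nonincreasing (a ∷ b ∷ as) = (b ≤ᵇ a) ∧ nonincreasing (b ∷ as)

sumℕ : List ℕ → ℕ
sumℕ = foldr ℕ._+_ 0

productℕ : List ℕ → ℕ
productℕ = foldr ℕ._*_ 1

-- All partitions λ ⊢ k: every partition of k has at most k parts, each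
-- between 1 and k, so we filter all such lists (of every length 0..k).
partitions : ℕ → List (List ℕ)
partitions k =
  filterᵇ (λ p → nonincreasing p ∧ (sumℕ p ≡ᵇ k))
          (concatMap (tuples (map suc (upTo k))) (upTo (suc k)))

l : List ℕ → ℕ
l = length

t : ℕ → List ℕ → ℕ
t i p = length (filterᵇ (λ a → a ≡ᵇ i) p)

tFactorials : ℕ → List ℕ → ℕ
tFactorials k p = productℕ (map (λ i → t i p !) (map suc (upTo k)))

productℕ-factorials≢0 : (ns : List ℕ) → NonZero (productℕ (map _! ns))
productℕ-factorials≢0 []       = _
productℕ-factorials≢0 (n ∷ ns) =
  m*n≢0 (n !) (productℕ (map _! ns)) {{n !≢0}} {{productℕ-factorials≢0 ns}}

multinomial-denominator : ℕ → ℕ → List ℕ → ℕ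
multinomial-denominator k m p = productℕ (map _! ((m ∸ l p) ∷ map (λ i → t i p) (map suc (upTo k))))

multinomial : ℕ → ℕ → List ℕ → ℕ
multinomial k m p =
  _/_ (m !) (multinomial-denominator k m p)
      {{productℕ-factorials≢0 ((m ∸ l p) ∷ map (λ i → t i p) (map suc (upTo k)))}}

data SymFam : Set where
  E H : SymFam

module _ {c ℓ : Level} (R : CommutativeRing c ℓ) where
  open CommutativeRing R
  open RS (Semiring.rawSemiring semiring) using (_×_) public

  Σᴿ : List Carrier → Carrier
  Σᴿ = foldr _+_ 0#

  Πᴿ : List Carrier → Carrier
  Πᴿ = foldr _*_ 1#

  eSym : ℕ → List Carrier → Carrier
  eSym j ys = Σᴿ (map (λ is → Πᴿ (map (lookup ys) is))
                      (filterᵇ strictlyIncreasing (tuples (allFin (length ys)) j)))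

  hSym : ℕ → List Carrier → Carrier
  hSym j ys = Σᴿ (map (λ is → Πᴿ (map (lookup ys) is))
                      (filterᵇ weaklyIncreasing (tuples (allFin (length ys)) j)))

  fSym : SymFam → ℕ → List Carrier → Carrier
  fSym E = eSym
  fSym H = hSym

  fPart : SymFam → List ℕ → List Carrier → Carrier
  fPart f p ys = Πᴿ (map (λ a → fSym f a ys) p)

  copies : ℕ → List Carrier → List Carrier
  copies m xs = concat (replicate m xs)

module Submission where

-- Let F(t) = Σⱼ fⱼ(x) tʲ. The recurrences e_{j+1}(y, ys) = y eⱼ(ys) + e_{j+1}(ys) and
-- h_{j+1}(y, ys) = y hⱼ(y, ys) + h_{j+1}(ys) say that F(t) is multiplicative in the list of
-- variables (with factors 1 + y t, resp. 1/(1 - y t)), so the left side is the coefficient of tᵏ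
-- in F(t)ᵐ. Write F≤b for F truncated after degree b. Since F≤(b+1) = F≤b + f_{b+1} t^{b+1}, the
-- binomial theorem expands the coefficient of tᵏ in F≤(b+1)ᵐ according to the multiplicity s of
-- the part b+1, and C(m,s) times the multinomial coefficient of the remaining partition with
-- m - s available slots is the multinomial coefficient of the whole partition. By induction on b,
-- the coefficient of tᵏ in F≤bᵐ is the sum over partitions of k into at most m parts of size
-- ≤ b, and for b = k the truncation does not change the coefficient of tᵏ.

open import Algebra.Bundles using (CommutativeRing; CommutativeSemiring)
open import Data.Bool using (Bool; true; false; if_then_else_; _∧_)
open import Data.Nat as ℕ using (ℕ; zero; suc; _≤_; z≤n; s≤s; _∸_; _<ᵇ_; _≤ᵇ_)
open import Data.Nat.Properties using (≤-refl; ≤-trans; m≤n⇒m≤1+n)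
open import Data.Fin using (Fin; toℕ) renaming (zero to fzero; suc to fsuc)
open import Data.List using (List; []; _∷_; _++_; map; concatMap; filterᵇ; applyUpTo; tabulate; allFin; lookup; length; upTo)
open import Data.List.Properties using (map-++; map-∘; map-tabulate)
open import Data.List.Relation.Unary.All using (All; []; _∷_)
open import Data.List.Relation.Unary.All.Properties using (tabulate⁺)
open import Data.List.Relation.Binary.Permutation.Propositional as ↭ using (_↭_)
open import Data.Product using (_,_)
open import Function using (_∘_; id)
open import Relation.Binary.PropositionalEquality as ≡ using (_≡_)

open import Defs hiding (_×_)

suc-≤ᵇ-suc : ∀ m n → (suc m ≤ᵇ suc n) ≡ (m ≤ᵇ n)
suc-≤ᵇ-suc zero    n = ≡.refl
suc-≤ᵇ-suc (suc m) n = ≡.refl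

module ListSums {c ℓ} (R : CommutativeRing c ℓ) where

  open CommutativeRing R hiding (zero)
  open import Relation.Binary.Reasoning.Setoid setoid
  open import Algebra.Properties.Semiring.Mult semiring using (_×_)
  open import Algebra.Properties.CommutativeMonoid.Mult +-commutativeMonoid using (×-distrib-+)

  sumOver : ∀ {a} {A : Set a} → (A → Carrier) → List A → Carrier
  sumOver g xs = Σᴿ R (map g xs)

  when : ∀ {a} {A : Set a} → (A → Bool) → (A → Carrier) → A → Carrier
  when p g x = if p x then g x else 0#

  Σᴿ-++ : ∀ xs ys → Σᴿ R (xs ++ ys) ≈ Σᴿ R xs + Σᴿ R ys
  Σᴿ-++ []       ys = sym (+-identityˡ _)
  Σᴿ-++ (x ∷ xs) ys = trans (+-congˡ (Σᴿ-++ xs ys)) (sym (+-assoc _ _ _))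

  ×-zeroʳ : ∀ n → n × 0# ≈ 0#
  ×-zeroʳ zero    = refl
  ×-zeroʳ (suc n) = trans (+-identityˡ _) (×-zeroʳ n)

  module _ {a} {A : Set a} where

    sumOver-++ : ∀ (g : A → Carrier) xs ys → sumOver g (xs ++ ys) ≈ sumOver g xs + sumOver g ys
    sumOver-++ g xs ys = trans (reflexive (≡.cong (Σᴿ R) (map-++ g xs ys))) (Σᴿ-++ (map g xs) (map g ys))

    sumOver-cong-All : ∀ {g h : A → Carrier} {xs} → All (λ x → g x ≈ h x) xs → sumOver g xs ≈ sumOver h xs
    sumOver-cong-All []       = refl
    sumOver-cong-All (e ∷ es) = +-cong e (sumOver-cong-All es)

    sumOver-cong : ∀ {g h : A → Carrier} → (∀ x → g x ≈ h x) → ∀ xs → sumOver g xs ≈ sumOver h xs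
    sumOver-cong e []       = refl
    sumOver-cong e (x ∷ xs) = +-cong (e x) (sumOver-cong e xs)

    sumOver-zero : ∀ {g : A → Carrier} → (∀ x → g x ≈ 0#) → ∀ xs → sumOver g xs ≈ 0#
    sumOver-zero e []       = refl
    sumOver-zero e (x ∷ xs) = trans (+-cong (e x) (sumOver-zero e xs)) (+-identityˡ _)

    sumOver-filter : ∀ (g : A → Carrier) p xs → sumOver g (filterᵇ p xs) ≈ sumOver (when p g) xs
    sumOver-filter g p []       = refl
    sumOver-filter g p (x ∷ xs) with p x
    ... | true  = +-congˡ (sumOver-filter g p xs)
    ... | false = trans (sumOver-filter g p xs) (sym (+-identityˡ _))

    *-distribˡ-sumOver : ∀ y (g : A → Carrier) xs → y * sumOver g xs ≈ sumOver (λ x → y * g x) xs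
    *-distribˡ-sumOver y g []       = zeroʳ y
    *-distribˡ-sumOver y g (x ∷ xs) = trans (distribˡ y _ _) (+-congˡ (*-distribˡ-sumOver y g xs))

    ×-distrib-sumOver : ∀ n (g : A → Carrier) xs → n × sumOver g xs ≈ sumOver (λ x → n × g x) xs
    ×-distrib-sumOver n g []       = ×-zeroʳ n
    ×-distrib-sumOver n g (x ∷ xs) = trans (×-distrib-+ _ _ n) (+-congˡ (×-distrib-sumOver n g xs))

    sumOver-↭ : ∀ (g : A → Carrier) {xs ys} → xs ↭ ys → sumOver g xs ≈ sumOver g ys
    sumOver-↭ g ↭.refl          = refl
    sumOver-↭ g (↭.prep x p)    = +-congˡ (sumOver-↭ g p)
    sumOver-↭ g (↭.swap x y p)  = begin
      g x + (g y + _) ≈⟨ sym (+-assoc _ _ _) ⟩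
      (g x + g y) + _ ≈⟨ +-cong (+-comm _ _) (sumOver-↭ g p) ⟩
      (g y + g x) + _ ≈⟨ +-assoc _ _ _ ⟩
      g y + (g x + _) ∎
    sumOver-↭ g (↭.trans p q)   = trans (sumOver-↭ g p) (sumOver-↭ g q)

    sumOver-when-cong : ∀ (g : A → Carrier) {p q : A → Bool} → (∀ x → p x ≡ q x) →
                        ∀ xs → sumOver (when p g) xs ≈ sumOver (when q g) xs
    sumOver-when-cong g p≡q = sumOver-cong (λ x → reflexive (≡.cong (λ b → if b then g x else 0#) (p≡q x)))

  if-*ˡ : ∀ y b x → (if b then y * x else 0#) ≈ y * (if b then x else 0#)
  if-*ˡ y true  x = refl
  if-*ˡ y false x = sym (zeroʳ y)

  module _ {a b} {A : Set a} {B : Set b} where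

    sumOver-map : ∀ (g : B → Carrier) (f : A → B) xs → sumOver g (map f xs) ≡ sumOver (g ∘ f) xs
    sumOver-map g f []       = ≡.refl
    sumOver-map g f (x ∷ xs) = ≡.cong (g (f x) +_) (sumOver-map g f xs)

    sumOver-concatMap : ∀ (g : B → Carrier) (f : A → List B) xs →
                        sumOver g (concatMap f xs) ≈ sumOver (λ x → sumOver g (f x)) xs
    sumOver-concatMap g f []       = refl
    sumOver-concatMap g f (x ∷ xs) =
      trans (sumOver-++ g (f x) (concatMap f xs)) (+-congˡ (sumOver-concatMap g f xs))

  sumOver-applyUpTo-+ : ∀ (g : ℕ → Carrier) f n d → (∀ s → n ≤ s → g (f s) ≈ 0#) →
                        sumOver g (applyUpTo f (n ℕ.+ d)) ≈ sumOver g (applyUpTo f n)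
  sumOver-applyUpTo-+ g f zero    zero    vanish = refl
  sumOver-applyUpTo-+ g f zero    (suc d) vanish =
    trans (+-cong (vanish 0 z≤n) (sumOver-applyUpTo-+ g (f ∘ suc) 0 d (λ s _ → vanish (suc s) z≤n)))
          (+-identityˡ 0#)
  sumOver-applyUpTo-+ g f (suc n) d vanish =
    +-congˡ (sumOver-applyUpTo-+ g (f ∘ suc) n d (λ s le → vanish (suc s) (s≤s le)))

module IncreasingIndexSums {c ℓ} (R : CommutativeRing c ℓ) where

  open CommutativeRing R hiding (zero)
  open ListSums R
  open import Relation.Binary.Reasoning.Setoid setoid

  tupleSum : ∀ {a} {A : Set a} → List A → ℕ → (List A → Carrier) → Carrier
  tupleSum as j φ = sumOver φ (tuples as j)

  tupleSum-suc : ∀ {a} {A : Set a} (as : List A) j φ →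
                 tupleSum as (suc j) φ ≈ sumOver (λ x → tupleSum as j (φ ∘ (x ∷_))) as
  tupleSum-suc as j φ = trans (sumOver-concatMap φ (λ x → map (x ∷_) (tuples as j)) as)
                              (sumOver-cong (λ x → reflexive (sumOver-map φ (x ∷_) (tuples as j))) as)

  module Chains {a} {A : Set a} (r : A → A → Bool) where

    linksTo : A → List A → Bool
    linksTo x []      = true
    linksTo x (y ∷ _) = r x y

    isChain : List A → Bool
    isChain []       = true
    isChain (x ∷ is) = linksTo x is ∧ isChain is

    startingAt : A → (List A → Carrier) → List A → Carrier
    startingAt x φ is = if linksTo x is then φ (x ∷ is) else 0#

    chainSum : List A → ℕ → (List A → Carrier) → Carrier
    chainSum as j φ = tupleSum as j (when isChain φ)

    when-isChain-∷ : ∀ φ x is → when isChain φ (x ∷ is) ≈ when isChain (startingAt x φ) is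
    when-isChain-∷ φ x is with linksTo x is | isChain is
    ... | true  | true  = refl
    ... | true  | false = refl
    ... | false | true  = refl
    ... | false | false = refl

    -- Chains over a₀ ∷ bs either start at a₀ or avoid a₀, since no element of bs links back to a₀.
    module FirstElement (a₀ : A) (bs : List A) (noLinkBack : All (λ b → r b a₀ ≡ false) bs) where

      chainSumFrom : ℕ → (List A → Carrier) → Carrier
      chainSumFrom zero    φ = 0#
      chainSumFrom (suc j) φ = chainSum (a₀ ∷ bs) j (startingAt a₀ φ)

      chainSumFrom-after : ∀ b → r b a₀ ≡ false → ∀ j φ → chainSumFrom j (startingAt b φ) ≈ 0#
      chainSumFrom-after b b↛a₀ zero    φ = refl
      chainSumFrom-after b b↛a₀ (suc j) φ = sumOver-zero vanish (tuples (a₀ ∷ bs) j)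
        where
        vanish : ∀ is → when isChain (startingAt a₀ (startingAt b φ)) is ≈ 0#
        vanish is with isChain is | linksTo a₀ is
        ... | false | _     = refl
        ... | true  | false = refl
        ... | true  | true  rewrite b↛a₀ = refl

      chainSum-split : ∀ j φ → chainSum (a₀ ∷ bs) j φ ≈ chainSumFrom j φ + chainSum bs j φ
      chainSum-split zero    φ = sym (+-identityˡ _)
      chainSum-split (suc j) φ = begin
        chainSum (a₀ ∷ bs) (suc j) φ
          ≈⟨ tupleSum-suc (a₀ ∷ bs) j (when isChain φ) ⟩
        tupleSum (a₀ ∷ bs) j (when isChain φ ∘ (a₀ ∷_))
          + sumOver (λ x → tupleSum (a₀ ∷ bs) j (when isChain φ ∘ (x ∷_))) bs
          ≈⟨ +-cong (sumOver-cong (when-isChain-∷ φ a₀) (tuples (a₀ ∷ bs) j))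
                    (sumOver-cong-All (avoid bs noLinkBack)) ⟩
        chainSumFrom (suc j) φ + sumOver (λ x → tupleSum bs j (when isChain φ ∘ (x ∷_))) bs
          ≈⟨ +-congˡ (tupleSum-suc bs j (when isChain φ)) ⟨
        chainSumFrom (suc j) φ + chainSum bs (suc j) φ ∎
        where
        avoid : ∀ cs → All (λ b → r b a₀ ≡ false) cs →
                All (λ x → tupleSum (a₀ ∷ bs) j (when isChain φ ∘ (x ∷_))
                         ≈ tupleSum bs j (when isChain φ ∘ (x ∷_))) cs
        avoid []       []            = []
        avoid (b ∷ cs) (b↛a₀ ∷ rest) = avoidFrom ∷ avoid cs rest
          where
          avoidFrom : tupleSum (a₀ ∷ bs) j (when isChain φ ∘ (b ∷_)) ≈ tupleSum bs j (when isChain φ ∘ (b ∷_))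
          avoidFrom = begin
            tupleSum (a₀ ∷ bs) j (when isChain φ ∘ (b ∷_))
              ≈⟨ sumOver-cong (when-isChain-∷ φ b) (tuples (a₀ ∷ bs) j) ⟩
            chainSum (a₀ ∷ bs) j (startingAt b φ)
              ≈⟨ chainSum-split j (startingAt b φ) ⟩
            chainSumFrom j (startingAt b φ) + chainSum bs j (startingAt b φ)
              ≈⟨ +-congʳ (chainSumFrom-after b b↛a₀ j φ) ⟩
            0# + chainSum bs j (startingAt b φ)
              ≈⟨ +-identityˡ _ ⟩
            chainSum bs j (startingAt b φ)
              ≈⟨ sumOver-cong (λ is → sym (when-isChain-∷ φ b is)) (tuples bs j) ⟩
            tupleSum bs j (when isChain φ ∘ (b ∷_)) ∎

  open Chains using (isChain; linksTo; startingAt; chainSum)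

  tuples-map : ∀ {a b} {A : Set a} {B : Set b} (f : A → B) as j →
               tuples (map f as) j ≡ map (map f) (tuples as j)
  tuples-map f as zero    = ≡.refl
  tuples-map f as (suc j) rewrite tuples-map f as j = prefixes as
    where
    prefixes : ∀ xs → concatMap (λ b → map (b ∷_) (map (map f) (tuples as j))) (map f xs)
                    ≡ map (map f) (concatMap (λ x → map (x ∷_) (tuples as j)) xs)
    prefixes []       = ≡.refl
    prefixes (x ∷ xs) = ≡.trans (≡.cong₂ _++_ (≡.trans (≡.sym (map-∘ (tuples as j))) (map-∘ (tuples as j)))
                                               (prefixes xs))
                                (≡.sym (map-++ (map f) (map (x ∷_) (tuples as j)) _))

  _<ᶠ_ _≤ᶠ_ : ∀ {N} → Fin N → Fin N → Bool
  i <ᶠ j = toℕ i <ᵇ toℕ j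
  i ≤ᶠ j = toℕ i ≤ᵇ toℕ j

  strictlyIncreasing≡isChain : ∀ {N} (is : List (Fin N)) → strictlyIncreasing is ≡ isChain _<ᶠ_ is
  strictlyIncreasing≡isChain []           = ≡.refl
  strictlyIncreasing≡isChain (i ∷ [])     = ≡.refl
  strictlyIncreasing≡isChain (i ∷ j ∷ is) = ≡.cong ((i <ᶠ j) ∧_) (strictlyIncreasing≡isChain (j ∷ is))

  weaklyIncreasing≡isChain : ∀ {N} (is : List (Fin N)) → weaklyIncreasing is ≡ isChain _≤ᶠ_ is
  weaklyIncreasing≡isChain []           = ≡.refl
  weaklyIncreasing≡isChain (i ∷ [])     = ≡.refl
  weaklyIncreasing≡isChain (i ∷ j ∷ is) = ≡.cong ((i ≤ᶠ j) ∧_) (weaklyIncreasing≡isChain (j ∷ is))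

  ≤ᶠ-suc : ∀ {N} (i j : Fin N) → fsuc i ≤ᶠ fsuc j ≡ i ≤ᶠ j
  ≤ᶠ-suc i j with toℕ i
  ... | zero  = ≡.refl
  ... | suc _ = ≡.refl

  indexProduct : (ys : List Carrier) → List (Fin (length ys)) → Carrier
  indexProduct ys is = Πᴿ R (map (lookup ys) is)

  indexProduct-suc : ∀ y ys is → indexProduct (y ∷ ys) (map fsuc is) ≡ indexProduct ys is
  indexProduct-suc y ys []       = ≡.refl
  indexProduct-suc y ys (i ∷ is) = ≡.cong (lookup ys i *_) (indexProduct-suc y ys is)

  module IncreasingSum (r : ∀ {N} → Fin N → Fin N → Bool)
                       (r-suc : ∀ {N} (i j : Fin N) → r (fsuc i) (fsuc j) ≡ r i j)
                       (r-suc-zero : ∀ {N} (i : Fin N) → r (fsuc i) fzero ≡ false) where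

    increasingSum : ℕ → List Carrier → Carrier
    increasingSum j ys = chainSum r (allFin (length ys)) j (indexProduct ys)

    isChain-map-suc : ∀ {N} (is : List (Fin N)) → isChain r (map fsuc is) ≡ isChain r is
    isChain-map-suc []           = ≡.refl
    isChain-map-suc (i ∷ [])     = ≡.refl
    isChain-map-suc (i ∷ j ∷ is) = ≡.cong₂ _∧_ (r-suc i j) (isChain-map-suc (j ∷ is))

    chainSum-shift : ∀ {N} j φ → chainSum r (tabulate {n = N} fsuc) j φ ≈ chainSum r (allFin N) j (φ ∘ map fsuc)
    chainSum-shift {N} j φ = begin
      sumOver (when (isChain r) φ) (tuples (tabulate fsuc) j)
        ≡⟨ ≡.cong (λ as → sumOver (when (isChain r) φ) (tuples as j)) (map-tabulate {n = N} (λ i → i) fsuc) ⟨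
      sumOver (when (isChain r) φ) (tuples (map fsuc (allFin N)) j)
        ≡⟨ ≡.cong (sumOver (when (isChain r) φ)) (tuples-map fsuc (allFin N) j) ⟩
      sumOver (when (isChain r) φ) (map (map fsuc) (tuples (allFin N) j))
        ≡⟨ sumOver-map (when (isChain r) φ) (map fsuc) (tuples (allFin N) j) ⟩
      sumOver (when (isChain r) φ ∘ map fsuc) (tuples (allFin N) j)
        ≈⟨ sumOver-when-cong (φ ∘ map fsuc) isChain-map-suc (tuples (allFin N) j) ⟩
      chainSum r (allFin N) j (φ ∘ map fsuc) ∎

    chainSum-tail : ∀ j y ys → chainSum r (tabulate fsuc) j (indexProduct (y ∷ ys)) ≈ increasingSum j ys
    chainSum-tail j y ys = trans (chainSum-shift j (indexProduct (y ∷ ys)))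
      (sumOver-cong (λ is → reflexive (≡.cong (λ v → if isChain r is then v else 0#) (indexProduct-suc y ys is)))
                    (tuples (allFin (length ys)) j))

    increasingSum-∷ : ∀ j y ys → increasingSum (suc j) (y ∷ ys) ≈
                 chainSum r (allFin (suc (length ys))) j (startingAt r fzero (indexProduct (y ∷ ys)))
                 + increasingSum (suc j) ys
    increasingSum-∷ j y ys = trans (chainSum-split (suc j) (indexProduct (y ∷ ys))) (+-congˡ (chainSum-tail (suc j) y ys))
      where open Chains.FirstElement r fzero (tabulate {n = length ys} fsuc) (tabulate⁺ r-suc-zero)

  module Strict = IncreasingSum _<ᶠ_ (λ _ _ → ≡.refl) (λ _ → ≡.refl)
  module Weak   = IncreasingSum _≤ᶠ_ ≤ᶠ-suc (λ _ → ≡.refl)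

  eSym≈increasingSum : ∀ j ys → eSym R j ys ≈ Strict.increasingSum j ys
  eSym≈increasingSum j ys = trans (sumOver-filter (indexProduct ys) strictlyIncreasing (tuples (allFin (length ys)) j))
    (sumOver-when-cong (indexProduct ys) strictlyIncreasing≡isChain (tuples (allFin (length ys)) j))

  hSym≈increasingSum : ∀ j ys → hSym R j ys ≈ Weak.increasingSum j ys
  hSym≈increasingSum j ys = trans (sumOver-filter (indexProduct ys) weaklyIncreasing (tuples (allFin (length ys)) j))
    (sumOver-when-cong (indexProduct ys) weaklyIncreasing≡isChain (tuples (allFin (length ys)) j))

  eSym-∷ : ∀ j y ys → eSym R (suc j) (y ∷ ys) ≈ y * eSym R j ys + eSym R (suc j) ys
  eSym-∷ j y ys = begin
    eSym R (suc j) (y ∷ ys)                     ≈⟨ eSym≈increasingSum (suc j) (y ∷ ys) ⟩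
    Strict.increasingSum (suc j) (y ∷ ys)       ≈⟨ Strict.increasingSum-∷ j y ys ⟩
    chainSum _<ᶠ_ (fzero ∷ tabulate fsuc) j ψ₀ + Strict.increasingSum (suc j) ys
      ≈⟨ +-cong startingAtZero (sym (eSym≈increasingSum (suc j) ys)) ⟩
    y * eSym R j ys + eSym R (suc j) ys ∎
    where
    open Chains.FirstElement _<ᶠ_ fzero (tabulate {n = length ys} fsuc) (tabulate⁺ (λ _ → ≡.refl))
    ψ₀ : List (Fin (suc (length ys))) → Carrier
    ψ₀ = startingAt _<ᶠ_ fzero (indexProduct (y ∷ ys))
    linksTo-zero : ∀ (is : List (Fin (length ys))) → linksTo _<ᶠ_ fzero (map fsuc is) ≡ true
    linksTo-zero []      = ≡.refl
    linksTo-zero (_ ∷ _) = ≡.refl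
    factorOut : ∀ (is : List (Fin (length ys))) →
                when (isChain _<ᶠ_) (ψ₀ ∘ map fsuc) is ≈ y * when (isChain _<ᶠ_) (indexProduct ys) is
    factorOut is rewrite linksTo-zero is | indexProduct-suc y ys is =
      if-*ˡ y (isChain _<ᶠ_ is) (indexProduct ys is)
    startingAtZero : chainSum _<ᶠ_ (fzero ∷ tabulate fsuc) j ψ₀ ≈ y * eSym R j ys
    startingAtZero = begin
      chainSum _<ᶠ_ (fzero ∷ tabulate fsuc) j ψ₀
        ≈⟨ chainSum-split j ψ₀ ⟩
      chainSumFrom j ψ₀ + chainSum _<ᶠ_ (tabulate fsuc) j ψ₀
        ≈⟨ +-congʳ (chainSumFrom-after fzero ≡.refl j (indexProduct (y ∷ ys))) ⟩
      0# + chainSum _<ᶠ_ (tabulate fsuc) j ψ₀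
        ≈⟨ trans (+-identityˡ _) (Strict.chainSum-shift j ψ₀) ⟩
      chainSum _<ᶠ_ (allFin (length ys)) j (ψ₀ ∘ map fsuc)
        ≈⟨ sumOver-cong factorOut (tuples (allFin (length ys)) j) ⟩
      sumOver (λ is → y * when (isChain _<ᶠ_) (indexProduct ys) is) (tuples (allFin (length ys)) j)
        ≈⟨ *-distribˡ-sumOver y _ (tuples (allFin (length ys)) j) ⟨
      y * Strict.increasingSum j ys
        ≈⟨ *-congˡ (eSym≈increasingSum j ys) ⟨
      y * eSym R j ys ∎

  hSym-∷ : ∀ j y ys → hSym R (suc j) (y ∷ ys) ≈ y * hSym R j (y ∷ ys) + hSym R (suc j) ys
  hSym-∷ j y ys = begin
    hSym R (suc j) (y ∷ ys)                   ≈⟨ hSym≈increasingSum (suc j) (y ∷ ys) ⟩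
    Weak.increasingSum (suc j) (y ∷ ys)       ≈⟨ Weak.increasingSum-∷ j y ys ⟩
    chainSum _≤ᶠ_ (allFin (suc (length ys))) j (startingAt _≤ᶠ_ fzero ψ) + Weak.increasingSum (suc j) ys
      ≈⟨ +-cong startingAtZero (sym (hSym≈increasingSum (suc j) ys)) ⟩
    y * hSym R j (y ∷ ys) + hSym R (suc j) ys ∎
    where
    ψ : List (Fin (suc (length ys))) → Carrier
    ψ = indexProduct (y ∷ ys)
    linksTo-zero : ∀ (is : List (Fin (suc (length ys)))) → linksTo _≤ᶠ_ fzero is ≡ true
    linksTo-zero []      = ≡.refl
    linksTo-zero (_ ∷ _) = ≡.refl
    factorOut : ∀ (is : List (Fin (suc (length ys)))) →
                when (isChain _≤ᶠ_) (startingAt _≤ᶠ_ fzero ψ) is ≈ y * when (isChain _≤ᶠ_) ψ is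
    factorOut is rewrite linksTo-zero is = if-*ˡ y (isChain _≤ᶠ_ is) (ψ is)
    startingAtZero : chainSum _≤ᶠ_ (allFin (suc (length ys))) j (startingAt _≤ᶠ_ fzero ψ) ≈ y * hSym R j (y ∷ ys)
    startingAtZero = begin
      chainSum _≤ᶠ_ (allFin (suc (length ys))) j (startingAt _≤ᶠ_ fzero ψ)
        ≈⟨ sumOver-cong factorOut (tuples (allFin (suc (length ys))) j) ⟩
      sumOver (λ is → y * when (isChain _≤ᶠ_) ψ is) (tuples (allFin (suc (length ys))) j)
        ≈⟨ *-distribˡ-sumOver y _ (tuples (allFin (suc (length ys))) j) ⟨
      y * Weak.increasingSum j (y ∷ ys)
        ≈⟨ *-congˡ (hSym≈increasingSum j (y ∷ ys)) ⟨
      y * hSym R j (y ∷ ys) ∎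

module FormalPowerSeries {c ℓ} (R : CommutativeRing c ℓ) where

  open CommutativeRing R hiding (zero)
  open import Relation.Binary.Reasoning.Setoid setoid

  PowerSeries : Set c
  PowerSeries = ℕ → Carrier

  infix  4 _≈ₚ_
  infixl 6 _+ₚ_
  infixl 7 _*ₚ_

  _≈ₚ_ : PowerSeries → PowerSeries → Set ℓ
  f ≈ₚ g = ∀ k → f k ≈ g k

  _+ₚ_ : PowerSeries → PowerSeries → PowerSeries
  (f +ₚ g) k = f k + g k

  0ₚ 1ₚ : PowerSeries
  0ₚ k       = 0#
  1ₚ zero    = 1#
  1ₚ (suc k) = 0#

  _*ₚ_ : PowerSeries → PowerSeries → PowerSeries
  (f *ₚ g) zero    = f 0 * g 0
  (f *ₚ g) (suc k) = f 0 * g (suc k) + (f ∘ suc *ₚ g) k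

  *ₚ-cong : ∀ {f f′ g g′} → f ≈ₚ f′ → g ≈ₚ g′ → f *ₚ g ≈ₚ f′ *ₚ g′
  *ₚ-cong f≈ g≈ zero    = *-cong (f≈ 0) (g≈ 0)
  *ₚ-cong f≈ g≈ (suc k) = +-cong (*-cong (f≈ 0) (g≈ (suc k))) (*ₚ-cong (f≈ ∘ suc) g≈ k)

  *ₚ-distribʳ : ∀ f g h → (f +ₚ g) *ₚ h ≈ₚ f *ₚ h +ₚ g *ₚ h
  *ₚ-distribʳ f g h zero    = distribʳ _ _ _
  *ₚ-distribʳ f g h (suc k) = trans (+-cong (distribʳ _ _ _) (*ₚ-distribʳ (f ∘ suc) (g ∘ suc) h k))
                                    (+-assoc-middle _ _ _ _)
    where
    +-assoc-middle : ∀ a b c d → (a + b) + (c + d) ≈ (a + c) + (b + d)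
    +-assoc-middle a b c d = begin
      (a + b) + (c + d) ≈⟨ +-assoc a b (c + d) ⟩
      a + (b + (c + d)) ≈⟨ +-congˡ (trans (sym (+-assoc b c d)) (trans (+-congʳ (+-comm b c)) (+-assoc c b d))) ⟩
      a + (c + (b + d)) ≈⟨ sym (+-assoc a c (b + d)) ⟩
      (a + c) + (b + d) ∎

  *ₚ-scaleˡ : ∀ a f g → (λ i → a * f i) *ₚ g ≈ₚ (λ k → a * (f *ₚ g) k)
  *ₚ-scaleˡ a f g zero    = *-assoc _ _ _
  *ₚ-scaleˡ a f g (suc k) = trans (+-cong (*-assoc _ _ _) (*ₚ-scaleˡ a (f ∘ suc) g k)) (sym (distribˡ _ _ _))

  *ₚ-zeroˡ : ∀ g → 0ₚ *ₚ g ≈ₚ 0ₚ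
  *ₚ-zeroˡ g zero    = zeroˡ _
  *ₚ-zeroˡ g (suc k) = trans (+-cong (zeroˡ _) (*ₚ-zeroˡ g k)) (+-identityˡ _)

  *ₚ-identityˡ : ∀ g → 1ₚ *ₚ g ≈ₚ g
  *ₚ-identityˡ g zero    = *-identityˡ _
  *ₚ-identityˡ g (suc k) = trans (+-cong (*-identityˡ _) (*ₚ-zeroˡ g k)) (+-identityʳ _)

  *ₚ-suc-last : ∀ f g k → (f *ₚ g) (suc k) ≈ (f *ₚ g ∘ suc) k + f (suc k) * g 0
  *ₚ-suc-last f g zero    = refl
  *ₚ-suc-last f g (suc k) = trans (+-congˡ (*ₚ-suc-last (f ∘ suc) g k)) (sym (+-assoc _ _ _))

  *ₚ-comm : ∀ f g → f *ₚ g ≈ₚ g *ₚ f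
  *ₚ-comm f g zero    = *-comm _ _
  *ₚ-comm f g (suc k) = begin
    f 0 * g (suc k) + (f ∘ suc *ₚ g) k ≈⟨ +-cong (*-comm _ _) (*ₚ-comm (f ∘ suc) g k) ⟩
    g (suc k) * f 0 + (g *ₚ f ∘ suc) k ≈⟨ +-comm _ _ ⟩
    (g *ₚ f ∘ suc) k + g (suc k) * f 0 ≈⟨ *ₚ-suc-last g f k ⟨
    (g *ₚ f) (suc k)                   ∎

  *ₚ-assoc : ∀ f g h → (f *ₚ g) *ₚ h ≈ₚ f *ₚ (g *ₚ h)
  *ₚ-assoc f g h zero    = *-assoc _ _ _
  *ₚ-assoc f g h (suc k) = begin
    (f 0 * g 0) * h (suc k) + ((f *ₚ g) ∘ suc *ₚ h) k
      ≈⟨ +-cong (*-assoc _ _ _) (*ₚ-distribʳ (λ i → f 0 * g (suc i)) (f ∘ suc *ₚ g) h k) ⟩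
    f 0 * (g 0 * h (suc k)) + (((λ i → f 0 * g (suc i)) *ₚ h) k + ((f ∘ suc *ₚ g) *ₚ h) k)
      ≈⟨ +-congˡ (+-cong (*ₚ-scaleˡ (f 0) (g ∘ suc) h k) (*ₚ-assoc (f ∘ suc) g h k)) ⟩
    f 0 * (g 0 * h (suc k)) + (f 0 * (g ∘ suc *ₚ h) k + (f ∘ suc *ₚ (g *ₚ h)) k)
      ≈⟨ sym (+-assoc _ _ _) ⟩
    (f 0 * (g 0 * h (suc k)) + f 0 * (g ∘ suc *ₚ h) k) + (f ∘ suc *ₚ (g *ₚ h)) k
      ≈⟨ +-congʳ (sym (distribˡ _ _ _)) ⟩
    f 0 * (g *ₚ h) (suc k) + (f ∘ suc *ₚ (g *ₚ h)) k ∎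

  powerSeriesSemiring : CommutativeSemiring c ℓ
  powerSeriesSemiring = record
    { Carrier = PowerSeries ; _≈_ = _≈ₚ_ ; _+_ = _+ₚ_ ; _*_ = _*ₚ_ ; 0# = 0ₚ ; 1# = 1ₚ
    ; isCommutativeSemiring = record
      { isSemiring = record
        { isSemiringWithoutAnnihilatingZero = record
          { +-isCommutativeMonoid = record
            { isMonoid = record
              { isSemigroup = record
                { isMagma = record
                  { isEquivalence = record
                    { refl = λ k → refl ; sym = λ e k → sym (e k) ; trans = λ e e′ k → trans (e k) (e′ k) }
                  ; ∙-cong = λ e e′ k → +-cong (e k) (e′ k) }
                ; assoc = λ f g h k → +-assoc _ _ _ }
              ; identity = (λ f k → +-identityˡ _) , (λ f k → +-identityʳ _) }
            ; comm = λ f g k → +-comm _ _ }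
          ; *-cong = *ₚ-cong
          ; *-assoc = *ₚ-assoc
          ; *-identity = *ₚ-identityˡ , λ f k → trans (*ₚ-comm f 1ₚ k) (*ₚ-identityˡ f k)
          ; distrib = (λ f g h k → trans (*ₚ-comm f (g +ₚ h) k)
                                   (trans (*ₚ-distribʳ g h f k) (+-cong (*ₚ-comm g f k) (*ₚ-comm h f k))))
                    , (λ f g h → *ₚ-distribʳ g h f) }
        ; zero = *ₚ-zeroˡ , λ f k → trans (*ₚ-comm f 0ₚ k) (*ₚ-zeroˡ f k) }
      ; *-comm = *ₚ-comm } }

  open import Algebra.Definitions.RawSemiring (CommutativeSemiring.rawSemiring powerSeriesSemiring) public
    using () renaming (_^_ to _^ₚ_; _×_ to _×ₚ_; sum to sumₚ)
  open import Algebra.Properties.Semiring.Exp (CommutativeSemiring.semiring powerSeriesSemiring)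
    using () renaming (^-congˡ to ^ₚ-congˡ)
  import Algebra.Properties.CommutativeSemiring.Binomial powerSeriesSemiring as Binomialₚ
  open import Algebra.Properties.Semiring.Exp semiring using (_^_)
  open import Algebra.Properties.Semiring.Mult semiring using (_×_; ×-congʳ)
  open import Algebra.Properties.Monoid.Sum +-monoid using (sum; sum-cong-≋)
  open import Data.Nat.Combinatorics using (_C_)
  open ListSums R using (sumOver)

  monomial : Carrier → ℕ → PowerSeries
  monomial a zero    zero    = a
  monomial a zero    (suc j) = 0#
  monomial a (suc d) zero    = 0#
  monomial a (suc d) (suc j) = monomial a d j

  shift : ℕ → PowerSeries → PowerSeries
  shift zero    f           = f
  shift (suc e) f zero      = 0#
  shift (suc e) f (suc k)   = shift e f k

  truncate : PowerSeries → ℕ → PowerSeries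
  truncate f b       zero    = f 0
  truncate f zero    (suc j) = 0#
  truncate f (suc b) (suc j) = truncate (f ∘ suc) b j

  truncate-agrees : ∀ f b j → j ≤ b → truncate f b j ≈ f j
  truncate-agrees f b       zero    _         = refl
  truncate-agrees f (suc b) (suc j) (s≤s j≤b) = truncate-agrees (f ∘ suc) b j j≤b

  truncate-zero : ∀ f → truncate f 0 ≈ₚ monomial (f 0) 0
  truncate-zero f zero    = refl
  truncate-zero f (suc j) = refl

  truncate-suc : ∀ f b → truncate f (suc b) ≈ₚ truncate f b +ₚ monomial (f (suc b)) (suc b)
  truncate-suc f b       zero    = sym (+-identityʳ _)
  truncate-suc f zero    (suc j) = trans (truncate-zero (f ∘ suc) j) (sym (+-identityˡ _))
  truncate-suc f (suc b) (suc j) = truncate-suc (f ∘ suc) b j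

  monomial-cong : ∀ {a b} d → a ≈ b → monomial a d ≈ₚ monomial b d
  monomial-cong zero    a≈b zero    = a≈b
  monomial-cong zero    a≈b (suc k) = refl
  monomial-cong (suc d) a≈b zero    = refl
  monomial-cong (suc d) a≈b (suc k) = monomial-cong d a≈b k

  monomial-*ₚ : ∀ a d f → monomial a d *ₚ f ≈ₚ (λ k → a * shift d f k)
  monomial-*ₚ a zero    f zero    = refl
  monomial-*ₚ a zero    f (suc k) = trans (+-congˡ (*ₚ-zeroˡ f k)) (+-identityʳ _)
  monomial-*ₚ a (suc d) f zero    = trans (zeroˡ _) (sym (zeroʳ a))
  monomial-*ₚ a (suc d) f (suc k) = trans (+-cong (zeroˡ _) (monomial-*ₚ a d f k)) (+-identityˡ _)

  shift-monomial : ∀ b d e → shift d (monomial b e) ≈ₚ monomial b (d ℕ.+ e)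
  shift-monomial b zero    e k       = refl
  shift-monomial b (suc d) e zero    = refl
  shift-monomial b (suc d) e (suc k) = shift-monomial b d e k

  *-monomial : ∀ a b d k → a * monomial b d k ≈ monomial (a * b) d k
  *-monomial a b zero    zero    = refl
  *-monomial a b zero    (suc k) = zeroʳ a
  *-monomial a b (suc d) zero    = zeroʳ a
  *-monomial a b (suc d) (suc k) = *-monomial a b d k

  monomial-^ₚ : ∀ a d s → monomial a d ^ₚ s ≈ₚ monomial (a ^ s) (s ℕ.* d)
  monomial-^ₚ a d zero    zero    = refl
  monomial-^ₚ a d zero    (suc k) = refl
  monomial-^ₚ a d (suc s) k       = begin
    (monomial a d *ₚ monomial a d ^ₚ s) k         ≈⟨ *ₚ-cong (λ _ → refl) (monomial-^ₚ a d s) k ⟩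
    (monomial a d *ₚ monomial (a ^ s) (s ℕ.* d)) k ≈⟨ monomial-*ₚ a d _ k ⟩
    a * shift d (monomial (a ^ s) (s ℕ.* d)) k     ≈⟨ *-congˡ (shift-monomial (a ^ s) d (s ℕ.* d) k) ⟩
    a * monomial (a ^ s) (d ℕ.+ s ℕ.* d) k         ≈⟨ *-monomial a (a ^ s) (d ℕ.+ s ℕ.* d) k ⟩
    monomial (a ^ suc s) (suc s ℕ.* d) k           ∎

  1ₚ-^ₚ : ∀ s → 1ₚ ^ₚ s ≈ₚ 1ₚ
  1ₚ-^ₚ zero    k = refl
  1ₚ-^ₚ (suc s) k = trans (*ₚ-identityˡ (1ₚ ^ₚ s) k) (1ₚ-^ₚ s k)

  shift-coefficient : ∀ e f k → shift e f k ≈ (if e ≤ᵇ k then f (k ∸ e) else 0#)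
  shift-coefficient zero    f k       = refl
  shift-coefficient (suc e) f zero    = refl
  shift-coefficient (suc e) f (suc k) = trans (shift-coefficient e f k) (reflexive (≡.cong
    (λ b → if b then f (k ∸ e) else 0#) (≡.sym (suc-≤ᵇ-suc e k))))

  AgreeUpTo : ℕ → PowerSeries → PowerSeries → Set ℓ
  AgreeUpTo k f g = ∀ j → j ≤ k → f j ≈ g j

  *ₚ-agreeUpTo : ∀ k {f f′ g g′} → AgreeUpTo k f f′ → AgreeUpTo k g g′ → (f *ₚ g) k ≈ (f′ *ₚ g′) k
  *ₚ-agreeUpTo zero    f≈ g≈ = *-cong (f≈ 0 z≤n) (g≈ 0 z≤n)
  *ₚ-agreeUpTo (suc k) f≈ g≈ = +-cong (*-cong (f≈ 0 z≤n) (g≈ (suc k) ≤-refl))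
    (*ₚ-agreeUpTo k (λ j j≤k → f≈ (suc j) (s≤s j≤k)) (λ j j≤k → g≈ j (m≤n⇒m≤1+n j≤k)))

  ^ₚ-agreeUpTo : ∀ k {f f′} → AgreeUpTo k f f′ → ∀ m → AgreeUpTo k (f ^ₚ m) (f′ ^ₚ m)
  ^ₚ-agreeUpTo k f≈ zero    j j≤k = refl
  ^ₚ-agreeUpTo k f≈ (suc m) j j≤k = *ₚ-agreeUpTo j (λ i i≤j → f≈ i (≤-trans i≤j j≤k))
                                                   (λ i i≤j → ^ₚ-agreeUpTo k f≈ m i (≤-trans i≤j j≤k))

  ×ₚ-coefficient : ∀ n f k → (n ×ₚ f) k ≈ n × f k
  ×ₚ-coefficient zero    f k = refl
  ×ₚ-coefficient (suc n) f k = +-congˡ (×ₚ-coefficient n f k)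

  sumₚ-coefficient : ∀ n (v : Fin n → PowerSeries) k → sumₚ v k ≈ sum (λ i → v i k)
  sumₚ-coefficient zero    v k = refl
  sumₚ-coefficient (suc n) v k = +-congˡ (sumₚ-coefficient n (v ∘ fsuc) k)

  sum≈sumOver-applyUpTo : ∀ n (g : ℕ → Carrier) (f : ℕ → ℕ) →
                          sum (λ (i : Fin n) → g (f (toℕ i))) ≈ sumOver g (applyUpTo f n)
  sum≈sumOver-applyUpTo zero    g f = refl
  sum≈sumOver-applyUpTo (suc n) g f = +-congˡ (sum≈sumOver-applyUpTo n g (f ∘ suc))

  truncatedPower : PowerSeries → ℕ → ℕ → PowerSeries
  truncatedPower f m b = truncate f b ^ₚ m

  -- The s-th term of the binomial expansion of (truncate f b + f (suc b) t^(suc b))^m, at t^k.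
  binomialTermAt : PowerSeries → ℕ → ℕ → ℕ → ℕ → Carrier
  binomialTermAt f m k b s = (m C s) × (f (suc b) ^ s *
    (if s ℕ.* suc b ≤ᵇ k then truncatedPower f (m ∸ s) b (k ∸ s ℕ.* suc b) else 0#))

  truncatedPower-suc : ∀ f m k b → truncatedPower f m (suc b) k ≈ sumOver (binomialTermAt f m k b) (upTo (suc m))
  truncatedPower-suc f m k b = begin
    (truncate f (suc b) ^ₚ m) k
      ≈⟨ ^ₚ-congˡ m (λ j → trans (truncate-suc f b j) (+-comm _ _)) k ⟩
    ((x +ₚ y) ^ₚ m) k
      ≈⟨ Binomialₚ.theorem m x y k ⟩
    Binomialₚ.binomialExpansion x y m k
      ≈⟨ sumₚ-coefficient (suc m) (Binomialₚ.binomialTerm x y m) k ⟩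
    sum (λ i → Binomialₚ.binomialTerm x y m i k)
      ≈⟨ sum-cong-≋ {suc m} (λ i → termAt (toℕ i)) ⟩
    sum (λ (i : Fin (suc m)) → binomialTermAt f m k b (toℕ i))
      ≈⟨ sum≈sumOver-applyUpTo (suc m) (binomialTermAt f m k b) (λ i → i) ⟩
    sumOver (binomialTermAt f m k b) (upTo (suc m)) ∎
    where
    x = monomial (f (suc b)) (suc b)
    y = truncate f b
    termAt : ∀ s → ((m C s) ×ₚ (x ^ₚ s *ₚ y ^ₚ (m ∸ s))) k ≈ binomialTermAt f m k b s
    termAt s = begin
      ((m C s) ×ₚ (x ^ₚ s *ₚ y ^ₚ (m ∸ s))) k
        ≈⟨ ×ₚ-coefficient (m C s) _ k ⟩
      (m C s) × (x ^ₚ s *ₚ y ^ₚ (m ∸ s)) k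
        ≈⟨ ×-congʳ (m C s) (*ₚ-cong (monomial-^ₚ (f (suc b)) (suc b) s) (λ _ → refl) k) ⟩
      (m C s) × (monomial (f (suc b) ^ s) (s ℕ.* suc b) *ₚ y ^ₚ (m ∸ s)) k
        ≈⟨ ×-congʳ (m C s) (monomial-*ₚ (f (suc b) ^ s) (s ℕ.* suc b) (y ^ₚ (m ∸ s)) k) ⟩
      (m C s) × (f (suc b) ^ s * shift (s ℕ.* suc b) (y ^ₚ (m ∸ s)) k)
        ≈⟨ ×-congʳ (m C s) (*-congˡ (shift-coefficient (s ℕ.* suc b) (y ^ₚ (m ∸ s)) k)) ⟩
      binomialTermAt f m k b s ∎

  truncatedPower-zero : ∀ f → f 0 ≈ 1# → ∀ m → truncatedPower f m 0 ≈ₚ 1ₚ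
  truncatedPower-zero f f₀≈1 m k = begin
    (truncate f 0 ^ₚ m) k ≈⟨ ^ₚ-congˡ m (λ j → trans (truncate-zero f j) (monomial-cong 0 f₀≈1 j)) k ⟩
    (monomial 1# 0 ^ₚ m) k ≈⟨ ^ₚ-congˡ m (λ { zero → refl ; (suc j) → refl }) k ⟩
    (1ₚ ^ₚ m) k            ≈⟨ 1ₚ-^ₚ m k ⟩
    1ₚ k                   ∎

  ^ₚ≈truncatedPower : ∀ f m k → (f ^ₚ m) k ≈ truncatedPower f m k k
  ^ₚ≈truncatedPower f m k = ^ₚ-agreeUpTo k (λ j j≤k → sym (truncate-agrees f k j j≤k)) m k ≤-refl

module GeneratingFunctions {c ℓ} (R : CommutativeRing c ℓ) where

  open CommutativeRing R hiding (zero)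
  open IncreasingIndexSums R using (eSym-∷; hSym-∷)
  open FormalPowerSeries R
  open import Relation.Binary.Reasoning.Setoid setoid
  open import Algebra.Properties.Semiring.Exp semiring using (_^_)

  genFun : SymFam → List Carrier → PowerSeries
  genFun f ys k = fSym R f k ys

  fSym-zero : ∀ f ys → fSym R f 0 ys ≈ 1#
  fSym-zero E ys = +-identityʳ 1#
  fSym-zero H ys = +-identityʳ 1#

  genFun-[] : ∀ f → genFun f [] ≈ₚ 1ₚ
  genFun-[] f zero    = fSym-zero f []
  genFun-[] E (suc k) = refl
  genFun-[] H (suc k) = refl

  -- 1 + y t for e, and 1/(1 - y t) = Σ y^k t^k for h.
  linearFactor : SymFam → Carrier → PowerSeries
  linearFactor E y zero          = 1#
  linearFactor E y (suc zero)    = y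
  linearFactor E y (suc (suc k)) = 0#
  linearFactor H y k             = y ^ k

  genFun-∷ : ∀ f y ys → genFun f (y ∷ ys) ≈ₚ linearFactor f y *ₚ genFun f ys
  genFun-∷ E y ys zero = trans (fSym-zero E (y ∷ ys)) (sym (trans (*-identityˡ _) (fSym-zero E ys)))
  genFun-∷ H y ys zero = trans (fSym-zero H (y ∷ ys)) (sym (trans (*-identityˡ _) (fSym-zero H ys)))
  genFun-∷ E y ys (suc k) = begin
    eSym R (suc k) (y ∷ ys)                         ≈⟨ eSym-∷ k y ys ⟩
    y * eSym R k ys + eSym R (suc k) ys             ≈⟨ +-comm _ _ ⟩
    eSym R (suc k) ys + y * eSym R k ys             ≈⟨ +-cong (sym (*-identityˡ _)) (sym (degreeOne k)) ⟩
    (linearFactor E y *ₚ genFun E ys) (suc k)       ∎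
    where
    degreeOne : ∀ k → (linearFactor E y ∘ suc *ₚ genFun E ys) k ≈ y * eSym R k ys
    degreeOne zero    = refl
    degreeOne (suc k) = trans (+-congˡ (*ₚ-zeroˡ (genFun E ys) k)) (+-identityʳ _)
  genFun-∷ H y ys (suc k) = begin
    hSym R (suc k) (y ∷ ys)                                ≈⟨ hSym-∷ k y ys ⟩
    y * hSym R k (y ∷ ys) + hSym R (suc k) ys              ≈⟨ +-comm _ _ ⟩
    hSym R (suc k) ys + y * hSym R k (y ∷ ys)              ≈⟨ +-cong (sym (*-identityˡ _)) (*-congˡ (genFun-∷ H y ys k)) ⟩
    1# * hSym R (suc k) ys + y * (linearFactor H y *ₚ genFun H ys) k
      ≈⟨ +-congˡ (sym (*ₚ-scaleˡ y (linearFactor H y) (genFun H ys) k)) ⟩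
    (linearFactor H y *ₚ genFun H ys) (suc k)              ∎

  genFun-++ : ∀ f ys zs → genFun f (ys ++ zs) ≈ₚ genFun f ys *ₚ genFun f zs
  genFun-++ f []       zs k = sym (trans (*ₚ-cong (genFun-[] f) (λ _ → refl) k) (*ₚ-identityˡ (genFun f zs) k))
  genFun-++ f (y ∷ ys) zs k = begin
    genFun f (y ∷ ys ++ zs) k                                   ≈⟨ genFun-∷ f y (ys ++ zs) k ⟩
    (linearFactor f y *ₚ genFun f (ys ++ zs)) k                 ≈⟨ *ₚ-cong (λ _ → refl) (genFun-++ f ys zs) k ⟩
    (linearFactor f y *ₚ (genFun f ys *ₚ genFun f zs)) k        ≈⟨ *ₚ-assoc (linearFactor f y) (genFun f ys) (genFun f zs) k ⟨
    ((linearFactor f y *ₚ genFun f ys) *ₚ genFun f zs) k        ≈⟨ *ₚ-cong (λ j → sym (genFun-∷ f y ys j)) (λ _ → refl) k ⟩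
    (genFun f (y ∷ ys) *ₚ genFun f zs) k                        ∎

  genFun-copies : ∀ f m xs → genFun f (copies R m xs) ≈ₚ genFun f xs ^ₚ m
  genFun-copies f zero    xs   = genFun-[] f
  genFun-copies f (suc m) xs k =
    trans (genFun-++ f xs (copies R m xs) k) (*ₚ-cong (λ _ → refl) (genFun-copies f m xs) k)

module PartitionCounting where

  open import Data.Unit using (tt)
  open import Data.Empty using (⊥-elim)
  open import Data.Bool using (T)
  open import Data.Bool.Properties using (T-∧)
  open import Data.Nat using (_+_; _*_; _<_; _≡ᵇ_; _!)
  open import Data.Nat.Properties
  open import Data.Nat.DivMod using (_/_; m*n/n≡m; m/n*n≡m)
  open import Data.Nat.Combinatorics using (_C_; nCk≡n!/k![n-k]!; k![n∸k]!∣n!)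
  open import Data.List using (replicate)
  open import Data.List.Properties using (length-++; length-replicate; map-∘)
  open import Data.List.Relation.Unary.All as All using ()
  open import Data.List.Relation.Unary.Any using (here; there)
  open import Data.List.Membership.Propositional using (_∈_)
  open import Data.List.Membership.Propositional.Properties using (∈-map⁺; ∈-upTo⁺)
  open import Data.List.Relation.Unary.Unique.Propositional using (Unique)
  import Data.List.Relation.Unary.Unique.Propositional.Properties as Unique
  open import Data.List.Relation.Unary.AllPairs using ([]; _∷_)
  open import Data.Product using (Σ; _×_; proj₁; proj₂)
  open import Function.Bundles using (Equivalence)
  open import Relation.Binary.PropositionalEquality
  open import Relation.Nullary using (yes; no)
  open import Algebra.Properties.CommutativeSemigroup *-commutativeSemigroup using (x∙yz≈y∙xz)

  nonincreasing-tail : ∀ x q → T (nonincreasing (x ∷ q)) → T (nonincreasing q)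
  nonincreasing-tail x []      _  = tt
  nonincreasing-tail x (y ∷ q) ni = proj₂ (Equivalence.to T-∧ ni)

  nonincreasing⇒≤head : ∀ x q → T (nonincreasing (x ∷ q)) → All (_≤ x) q
  nonincreasing⇒≤head x []      _  = []
  nonincreasing⇒≤head x (y ∷ q) ni =
    y≤x ∷ All.map (λ z≤y → ≤-trans z≤y y≤x) (nonincreasing⇒≤head y q (nonincreasing-tail x (y ∷ q) ni))
    where y≤x = ≤ᵇ⇒≤ y x (proj₁ (Equivalence.to T-∧ ni))

  nonincreasing-replicate-++ : ∀ s a q → T (nonincreasing q) → All (_≤ a) q →
                               T (nonincreasing (replicate s a ++ q))
  nonincreasing-replicate-++ zero          a q       ni _           = ni
  nonincreasing-replicate-++ (suc zero)    a []      ni _           = tt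
  nonincreasing-replicate-++ (suc zero)    a (y ∷ q) ni (y≤a ∷ _)   = Equivalence.from T-∧ (≤⇒≤ᵇ y≤a , ni)
  nonincreasing-replicate-++ (suc (suc s)) a q       ni q≤a         =
    Equivalence.from T-∧ (≤⇒≤ᵇ (≤-refl {a}) , nonincreasing-replicate-++ (suc s) a q ni q≤a)

  nonincreasing-++⁻ʳ : ∀ xs ys → T (nonincreasing (xs ++ ys)) → T (nonincreasing ys)
  nonincreasing-++⁻ʳ []       ys ni = ni
  nonincreasing-++⁻ʳ (x ∷ xs) ys ni = nonincreasing-++⁻ʳ xs ys (nonincreasing-tail x (xs ++ ys) ni)

  sumℕ-replicate : ∀ s a → sumℕ (replicate s a) ≡ s * a
  sumℕ-replicate zero    a = refl
  sumℕ-replicate (suc s) a = cong (a +_) (sumℕ-replicate s a)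

  length-replicate-++ : ∀ s (a : ℕ) q → length (replicate s a ++ q) ≡ s + length q
  length-replicate-++ s a q = trans (length-++ (replicate s a)) (cong (_+ length q) (length-replicate s))

  splitLargest : ∀ b p → T (nonincreasing p) → All (_≤ suc b) p →
                 Σ ℕ λ s → Σ (List ℕ) λ q → p ≡ replicate s (suc b) ++ q × All (_≤ b) q
  splitLargest b []      ni []           = 0 , [] , refl , []
  splitLargest b (x ∷ q) ni (x≤1+b ∷ q≤) with x ≟ suc b
  ... | yes refl = let (s , q′ , p≡ , q′≤b) = splitLargest b q (nonincreasing-tail x q ni) q≤
                   in suc s , q′ , cong (suc b ∷_) p≡ , q′≤b
  ... | no x≢1+b = 0 , x ∷ q , refl , x≤b ∷ All.map (λ y≤x → ≤-trans y≤x x≤b) (nonincreasing⇒≤head x q ni)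
    where x≤b = ≤-pred (≤∧≢⇒< x≤1+b x≢1+b)

  t-++ : ∀ i xs ys → t i (xs ++ ys) ≡ t i xs + t i ys
  t-++ i []       ys = refl
  t-++ i (x ∷ xs) ys with x ≡ᵇ i
  ... | true  = cong suc (t-++ i xs ys)
  ... | false = t-++ i xs ys

  t-replicate-≡ : ∀ s a → t a (replicate s a) ≡ s
  t-replicate-≡ zero    a = refl
  t-replicate-≡ (suc s) a with a ≡ᵇ a | ≡⇒≡ᵇ a a refl
  ... | true | _ = cong suc (t-replicate-≡ s a)

  t-∷-≢ : ∀ i a q → a ≢ i → t i (a ∷ q) ≡ t i q
  t-∷-≢ i a q a≢i with a ≡ᵇ i in eq
  ... | false = refl
  ... | true  = ⊥-elim (a≢i (≡ᵇ⇒≡ a i (subst T (sym eq) tt)))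

  t-replicate-≢ : ∀ i s a → a ≢ i → t i (replicate s a) ≡ 0
  t-replicate-≢ i zero    a a≢i = refl
  t-replicate-≢ i (suc s) a a≢i = trans (t-∷-≢ i a _ a≢i) (t-replicate-≢ i s a a≢i)

  t-<-all : ∀ a p → All (_< a) p → t a p ≡ 0
  t-<-all a []      []           = refl
  t-<-all a (x ∷ p) (x<a ∷ p<a) = trans (t-∷-≢ a x p (<⇒≢ x<a)) (t-<-all a p p<a)

  t-replicate-++ : ∀ s a q → All (_< a) q → t a (replicate s a ++ q) ≡ s
  t-replicate-++ s a q q<a = trans (t-++ a (replicate s a) q)
    (trans (cong₂ _+_ (t-replicate-≡ s a) (t-<-all a q q<a)) (+-identityʳ s))

  product-map-All : ∀ (g h : ℕ → ℕ) L → All (λ i → g i ≡ h i) L → productℕ (map g L) ≡ productℕ (map h L)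
  product-map-All g h []      []       = refl
  product-map-All g h (x ∷ L) (e ∷ es) = cong₂ _*_ e (product-map-All g h L es)

  product-map-single : ∀ (g h : ℕ → ℕ) a c L → Unique L → a ∈ L → (∀ i → i ≢ a → g i ≡ h i) →
                       g a ≡ c * h a → productℕ (map g L) ≡ c * productℕ (map h L)
  product-map-single g h a c (x ∷ L) (a∉L ∷ _) (here refl) g≡h ga≡ = begin
    g a * productℕ (map g L)
      ≡⟨ cong₂ _*_ ga≡ (product-map-All g h L (All.map (λ a≢i → g≡h _ (a≢i ∘ sym)) a∉L)) ⟩
    c * h a * productℕ (map h L) ≡⟨ *-assoc c (h a) _ ⟩
    c * (h a * productℕ (map h L)) ∎
    where open ≡-Reasoning
  product-map-single g h a c (x ∷ L) (x∉L ∷ u) (there a∈L) g≡h ga≡ = begin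
    g x * productℕ (map g L)
      ≡⟨ cong₂ _*_ (g≡h x (All.lookup x∉L a∈L)) (product-map-single g h a c L u a∈L g≡h ga≡) ⟩
    h x * (c * productℕ (map h L)) ≡⟨ x∙yz≈y∙xz (h x) c _ ⟩
    c * (h x * productℕ (map h L)) ∎
    where open ≡-Reasoning

  partSizes : ℕ → List ℕ
  partSizes K = map suc (upTo K)

  partSizes-unique : ∀ K → Unique (partSizes K)
  partSizes-unique K = Unique.map⁺ suc-injective (Unique.upTo⁺ K)

  ∈-partSizes : ∀ {a K} → 1 ≤ a → a ≤ K → a ∈ partSizes K
  ∈-partSizes {suc a} (s≤s _) a≤K = ∈-map⁺ suc (∈-upTo⁺ a≤K)

  tFactorials-[] : ∀ K → tFactorials K [] ≡ 1
  tFactorials-[] K = allOnes (partSizes K)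
    where
    allOnes : ∀ L → productℕ (map (λ i → t i [] !) L) ≡ 1
    allOnes []      = refl
    allOnes (x ∷ L) = trans (+-identityʳ _) (allOnes L)

  tFactorials-replicate-++ : ∀ K s a q → 1 ≤ a → a ≤ K → All (_< a) q →
                             tFactorials K (replicate s a ++ q) ≡ s ! * tFactorials K q
  tFactorials-replicate-++ K s a q 1≤a a≤K q<a =
    product-map-single _ _ a (s !) (partSizes K) (partSizes-unique K) (∈-partSizes 1≤a a≤K) others atA
    where
    others : ∀ i → i ≢ a → t i (replicate s a ++ q) ! ≡ t i q !
    others i i≢a = cong _! (trans (t-++ i (replicate s a) q) (cong (_+ t i q) (t-replicate-≢ i s a (i≢a ∘ sym))))
    atA : t a (replicate s a ++ q) ! ≡ s ! * t a q !
    atA = begin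
      t a (replicate s a ++ q) ! ≡⟨ cong _! (t-replicate-++ s a q q<a) ⟩
      s !                        ≡⟨ *-identityʳ (s !) ⟨
      s ! * 0 !                  ≡⟨ cong (λ z → s ! * z !) (t-<-all a q q<a) ⟨
      s ! * t a q !              ∎
      where open ≡-Reasoning

  multinomial-denominator≡ : ∀ K m p → multinomial-denominator K m p ≡ (m ∸ l p) ! * tFactorials K p
  multinomial-denominator≡ K m p = cong (((m ∸ l p) !) *_) (cong productℕ (sym (map-∘ (partSizes K))))

  -- multinomial is defined by truncating division, so it is only meaningful when the division is exact.
  ExactMultinomial : ℕ → ℕ → List ℕ → Set
  ExactMultinomial K m p = multinomial-denominator K m p * multinomial K m p ≡ m !

  multinomial-unique : ∀ K m p X → m ! ≡ X * multinomial-denominator K m p → multinomial K m p ≡ X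
  multinomial-unique K m p X m!≡ =
    trans (cong (λ z → _/_ z (multinomial-denominator K m p) ⦃ nonZero ⦄) m!≡) (m*n/n≡m X _ ⦃ nonZero ⦄)
    where nonZero = productℕ-factorials≢0 ((m ∸ l p) ∷ map (λ i → t i p) (partSizes K))

  m!≡mCs*[s!*[m∸s]!] : ∀ {s m} → s ≤ m → m ! ≡ (m C s) * (s ! * (m ∸ s) !)
  m!≡mCs*[s!*[m∸s]!] {s} {m} s≤m = sym (trans (cong (_* (s ! * (m ∸ s) !)) (nCk≡n!/k![n-k]! s≤m))
    (m/n*n≡m ⦃ m*n≢0 (s !) ((m ∸ s) !) ⦃ s !≢0 ⦄ ⦃ (m ∸ s) !≢0 ⦄ ⦄ (k![n∸k]!∣n! s≤m)))

  multinomial-[] : ∀ K m → multinomial K m [] ≡ 1 × ExactMultinomial K m []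
  multinomial-[] K m = μ≡1 , trans (cong (multinomial-denominator K m [] *_) μ≡1) (trans (*-identityʳ _) denominator≡)
    where
    denominator≡ : multinomial-denominator K m [] ≡ m !
    denominator≡ = trans (multinomial-denominator≡ K m []) (trans (cong (m ! *_) (tFactorials-[] K)) (*-identityʳ (m !)))
    μ≡1 : multinomial K m [] ≡ 1
    μ≡1 = multinomial-unique K m [] 1 (sym (trans (*-identityˡ _) denominator≡))

  multinomial-replicate-++ : ∀ K m s a q → 1 ≤ a → a ≤ K → All (_< a) q → s + length q ≤ m →
    ExactMultinomial K (m ∸ s) q →
    multinomial K m (replicate s a ++ q) ≡ (m C s) * multinomial K (m ∸ s) q × ExactMultinomial K m (replicate s a ++ q)
  multinomial-replicate-++ K m s a q 1≤a a≤K q<a s+l≤m exact =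
    μ≡ , trans (cong (D *_) μ≡) (trans (*-comm D (c * μ)) (sym m!≡))
    where
    open ≡-Reasoning
    open import Data.Nat.Solver using (module +-*-Solver)
    open +-*-Solver
    p = replicate s a ++ q
    c = m C s
    μ = multinomial K (m ∸ s) q
    D′ = multinomial-denominator K (m ∸ s) q
    D = multinomial-denominator K m p
    D≡ : D ≡ s ! * D′
    D≡ = begin
      D                                               ≡⟨ multinomial-denominator≡ K m p ⟩
      (m ∸ length p) ! * tFactorials K p
        ≡⟨ cong₂ (λ u v → (m ∸ u) ! * v) (length-replicate-++ s a q) (tFactorials-replicate-++ K s a q 1≤a a≤K q<a) ⟩
      (m ∸ (s + length q)) ! * (s ! * tFactorials K q)
        ≡⟨ cong (λ u → u ! * (s ! * tFactorials K q)) (∸-+-assoc m s (length q)) ⟨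
      ((m ∸ s) ∸ length q) ! * (s ! * tFactorials K q)
        ≡⟨ x∙yz≈y∙xz ((m ∸ s ∸ length q) !) (s !) (tFactorials K q) ⟩
      s ! * ((m ∸ s ∸ length q) ! * tFactorials K q)   ≡⟨ cong (s ! *_) (multinomial-denominator≡ K (m ∸ s) q) ⟨
      s ! * D′                                        ∎
    m!≡ : m ! ≡ (c * μ) * D
    m!≡ = begin
      m !                    ≡⟨ m!≡mCs*[s!*[m∸s]!] (≤-trans (m≤m+n s (length q)) s+l≤m) ⟩
      c * (s ! * (m ∸ s) !)  ≡⟨ cong (λ z → c * (s ! * z)) exact ⟨
      c * (s ! * (D′ * μ))   ≡⟨ solve 4 (λ c f d x → c :* (f :* (d :* x)) := (c :* x) :* (f :* d)) refl c (s !) D′ μ ⟩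
      (c * μ) * (s ! * D′)   ≡⟨ cong ((c * μ) *_) D≡ ⟨
      (c * μ) * D            ∎
    μ≡ : multinomial K m p ≡ c * μ
    μ≡ = multinomial-unique K m p (c * μ) m!≡

module BoundedPartitions where

  open PartitionCounting
  open import Data.Unit using (tt)
  open import Data.Empty using (⊥-elim)
  open import Data.Bool using (T; T?)
  open import Data.Bool.Properties using (T-∧)
  open import Data.Nat using (_+_; _*_; _≡ᵇ_)
  open import Data.Nat.Properties
  open import Data.Nat.ListAction.Properties using (sum-++)
  open import Data.List using (replicate; [_]; head)
  import Data.List.Properties as List
  open import Data.Maybe using (just)
  open import Data.Maybe.Properties using (just-injective)
  open import Data.List.Relation.Unary.All as All using ()
  import Data.List.Relation.Unary.All.Properties as All
  open import Data.List.Relation.Unary.Any using (here)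
  open import Data.List.Membership.Propositional using (_∈_; find; lose)
  open import Data.List.Membership.Propositional.Properties
    using (∈-map⁺; ∈-map⁻; ∈-upTo⁺; ∈-upTo⁻; ∈-concatMap⁺; ∈-concatMap⁻; ∈-filter⁺; ∈-filter⁻)
  open import Data.List.Membership.Propositional.Properties.WithK using (unique∧set⇒bag)
  open import Data.List.Relation.Binary.BagAndSetEquality using (∼bag⇒↭)
  open import Data.List.Relation.Unary.Unique.Propositional using (Unique)
  import Data.List.Relation.Unary.Unique.Propositional.Properties as Unique
  open import Data.List.Relation.Unary.AllPairs using ([]; _∷_)
  open import Data.Product using (Σ; _×_; proj₁; proj₂)
  open import Function.Bundles using (Equivalence; mk⇔)
  open import Relation.Binary.PropositionalEquality hiding ([_])
  open import Relation.Nullary using (¬_)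

  mutual
    -- The partitions of k with all parts ≤ b, grouped by the multiplicity s of the part b.
    boundedPartitions : ℕ → ℕ → List (List ℕ)
    boundedPartitions zero    zero    = [ [] ]
    boundedPartitions zero    (suc k) = []
    boundedPartitions (suc b) k       = concatMap (largestPartBlock b k) (upTo (suc k))

    largestPartBlock : ℕ → ℕ → ℕ → List (List ℕ)
    largestPartBlock b k s =
      if s * suc b ≤ᵇ k then map (replicate s (suc b) ++_) (boundedPartitions b (k ∸ s * suc b)) else []

  record IsPartition (b k : ℕ) (p : List ℕ) : Set where
    field
      nonincr  : T (nonincreasing p)
      sums     : sumℕ p ≡ k
      positive : All (1 ≤_) p
      bounded  : All (_≤ b) p
  open IsPartition

  ∈-largestPartBlock⁻ : ∀ b k s {p} → p ∈ largestPartBlock b k s →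
    s * suc b ≤ k × Σ (List ℕ) λ q → p ≡ replicate s (suc b) ++ q × q ∈ boundedPartitions b (k ∸ s * suc b)
  ∈-largestPartBlock⁻ b k s p∈ with s * suc b ≤ᵇ k in eq
  ... | true with ∈-map⁻ (replicate s (suc b) ++_) p∈
  ...   | q , q∈ , p≡ = ≤ᵇ⇒≤ _ _ (subst T (sym eq) tt) , q , p≡ , q∈

  ∈-boundedPartitions-suc⁻ : ∀ b k {p} → p ∈ boundedPartitions (suc b) k →
    Σ ℕ λ s → s * suc b ≤ k ×
      Σ (List ℕ) λ q → p ≡ replicate s (suc b) ++ q × q ∈ boundedPartitions b (k ∸ s * suc b)
  ∈-boundedPartitions-suc⁻ b k p∈ with find (∈-concatMap⁻ (largestPartBlock b k) {xs = upTo (suc k)} p∈)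
  ... | s , _ , p∈block = s , ∈-largestPartBlock⁻ b k s p∈block

  boundedPartitions-sound : ∀ b k p → p ∈ boundedPartitions b k → IsPartition b k p
  boundedPartitions-sound zero    zero    p (here refl) = record { nonincr = tt ; sums = refl ; positive = [] ; bounded = [] }
  boundedPartitions-sound (suc b) k       p p∈ with ∈-boundedPartitions-suc⁻ b k p∈
  ... | s , s*a≤k , q , refl , q∈ = record
    { nonincr  = nonincreasing-replicate-++ s (suc b) q (nonincr q-part) (All.map m≤n⇒m≤1+n (bounded q-part))
    ; sums     = trans (sum-++ (replicate s (suc b)) q)
                   (trans (cong₂ _+_ (sumℕ-replicate s (suc b)) (sums q-part)) (m+[n∸m]≡n s*a≤k))
    ; positive = All.++⁺ (All.replicate⁺ s (s≤s z≤n)) (positive q-part)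
    ; bounded  = All.++⁺ (All.replicate⁺ s ≤-refl) (All.map m≤n⇒m≤1+n (bounded q-part)) }
    where q-part = boundedPartitions-sound b (k ∸ s * suc b) q q∈

  length≤sumℕ : ∀ p → All (1 ≤_) p → length p ≤ sumℕ p
  length≤sumℕ []      []          = z≤n
  length≤sumℕ (x ∷ p) (1≤x ∷ 1≤p) = +-mono-≤ 1≤x (length≤sumℕ p 1≤p)

  boundedPartitions-complete : ∀ b k p → IsPartition b k p → p ∈ boundedPartitions b k
  boundedPartitions-complete zero    k []      part rewrite sym (sums part) = here refl
  boundedPartitions-complete zero    k (x ∷ p) part with positive part | bounded part
  ... | 1≤x ∷ _ | x≤0 ∷ _ = ⊥-elim (<⇒≱ 1≤x x≤0)
  boundedPartitions-complete (suc b) k p part with splitLargest b p (nonincr part) (bounded part)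
  ... | s , q , refl , q≤b = ∈-concatMap⁺ (largestPartBlock b k) (lose (∈-upTo⁺ (s≤s s≤k)) inBlock)
    where
    a = suc b
    sumℕ≡ : s * a + sumℕ q ≡ k
    sumℕ≡ = trans (cong (_+ sumℕ q) (sym (sumℕ-replicate s a))) (trans (sym (sum-++ (replicate s a) q)) (sums part))
    s*a≤k : s * a ≤ k
    s*a≤k = subst (s * a ≤_) sumℕ≡ (m≤m+n (s * a) (sumℕ q))
    s≤k : s ≤ k
    s≤k = ≤-trans (m≤m*n s a) s*a≤k
    q-part : IsPartition b (k ∸ s * a) q
    q-part = record
      { nonincr  = nonincreasing-++⁻ʳ (replicate s a) q (nonincr part)
      ; sums     = trans (sym (m+n∸m≡n (s * a) (sumℕ q))) (cong (_∸ s * a) sumℕ≡)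
      ; positive = All.++⁻ʳ (replicate s a) (positive part)
      ; bounded  = q≤b }
    inBlock : replicate s a ++ q ∈ largestPartBlock b k s
    inBlock with s * a ≤ᵇ k | ≤⇒≤ᵇ s*a≤k
    ... | true | _ = ∈-map⁺ (replicate s a ++_) (boundedPartitions-complete b (k ∸ s * a) q q-part)

  Unique-concatMap⁺ : ∀ {A B C : Set} (tag : A → C) (key : B → C) (f : A → List B) xs →
    (∀ {x y} → tag x ≡ tag y → x ≡ y) → Unique xs →
    (∀ x → Unique (f x)) → (∀ x → All (λ y → key y ≡ tag x) (f x)) → Unique (concatMap f xs)
  Unique-concatMap⁺ tag key f []       _   _              _        _      = []
  Unique-concatMap⁺ tag key f (x ∷ xs) inj (x∉xs ∷ uniq) uniqueFx keyFx =
    Unique.++⁺ (uniqueFx x) (Unique-concatMap⁺ tag key f xs inj uniq uniqueFx keyFx) disjoint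
    where
    disjoint : ∀ {v} → ¬ (v ∈ f x × v ∈ concatMap f xs)
    disjoint (v∈fx , v∈rest) with find (∈-concatMap⁻ f {xs = xs} v∈rest)
    ... | x′ , x′∈xs , v∈fx′ =
      All.lookup x∉xs x′∈xs (inj (trans (sym (All.lookup (keyFx x) v∈fx)) (All.lookup (keyFx x′) v∈fx′)))

  boundedPartitions-unique : ∀ b k → Unique (boundedPartitions b k)
  boundedPartitions-unique zero    zero    = [] ∷ []
  boundedPartitions-unique zero    (suc k) = []
  boundedPartitions-unique (suc b) k       =
    Unique-concatMap⁺ id (t (suc b)) (largestPartBlock b k) (upTo (suc k)) id (Unique.upTo⁺ (suc k))
      uniqueBlock multiplicity
    where
    uniqueBlock : ∀ s → Unique (largestPartBlock b k s)
    uniqueBlock s with s * suc b ≤ᵇ k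
    ... | true  = Unique.map⁺ (λ {x} {y} → List.++-cancelˡ (replicate s (suc b)) x y) (boundedPartitions-unique b _)
    ... | false = []
    multiplicity : ∀ s → All (λ p → t (suc b) p ≡ s) (largestPartBlock b k s)
    multiplicity s = All.tabulate λ p∈ → let (_ , q , p≡ , q∈) = ∈-largestPartBlock⁻ b k s p∈ in
      trans (cong (t (suc b)) p≡)
            (t-replicate-++ s (suc b) q (All.map s≤s (bounded (boundedPartitions-sound b _ q q∈))))

  tuples-sound : ∀ {A : Set} (as : List A) j p → p ∈ tuples as j → length p ≡ j × All (_∈ as) p
  tuples-sound as zero    p (here refl) = refl , []
  tuples-sound as (suc j) p p∈ with find (∈-concatMap⁻ (λ a → map (a ∷_) (tuples as j)) {xs = as} p∈)
  ... | a , a∈ , p∈a∷ with ∈-map⁻ (a ∷_) p∈a∷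
  ...   | q , q∈ , refl = cong suc (proj₁ (tuples-sound as j q q∈)) , a∈ ∷ proj₂ (tuples-sound as j q q∈)

  tuples-complete : ∀ {A : Set} (as : List A) p → All (_∈ as) p → p ∈ tuples as (length p)
  tuples-complete as []      []           = here refl
  tuples-complete as (x ∷ p) (x∈ ∷ p⊆as) = ∈-concatMap⁺ _ (lose x∈ (∈-map⁺ (x ∷_) (tuples-complete as p p⊆as)))

  tuples-unique : ∀ {A : Set} (as : List A) j → Unique as → Unique (tuples as j)
  tuples-unique as zero    _    = [] ∷ []
  tuples-unique as (suc j) uniq = Unique-concatMap⁺ just head (λ a → map (a ∷_) (tuples as j)) as just-injective uniq
    (λ a → Unique.map⁺ List.∷-injectiveʳ (tuples-unique as j uniq))
    (λ a → All.map⁺ (All.universal (λ _ → refl) _))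

  isPartitionᵇ : ℕ → List ℕ → Bool
  isPartitionᵇ K p = nonincreasing p ∧ (sumℕ p ≡ᵇ K)

  partitions-unique : ∀ K → Unique (partitions K)
  partitions-unique K = Unique.filter⁺ (T? ∘ isPartitionᵇ K)
    (Unique-concatMap⁺ id length (tuples (partSizes K)) (upTo (suc K)) id (Unique.upTo⁺ (suc K))
      (λ j → tuples-unique (partSizes K) j (partSizes-unique K))
      (λ j → All.tabulate (λ {p} p∈ → proj₁ (tuples-sound (partSizes K) j p p∈))))

  partitions-sound : ∀ K p → p ∈ partitions K → IsPartition K K p
  partitions-sound K p p∈ with ∈-filter⁻ (T? ∘ isPartitionᵇ K) {xs = concatMap (tuples (partSizes K)) (upTo (suc K))} p∈
  ... | p∈tuples , isPart with find (∈-concatMap⁻ (tuples (partSizes K)) {xs = upTo (suc K)} p∈tuples)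
  ...   | j , _ , p∈tuplesʲ = record
    { nonincr  = proj₁ (Equivalence.to T-∧ isPart)
    ; sums     = ≡ᵇ⇒≡ _ _ (proj₂ (Equivalence.to T-∧ isPart))
    ; positive = All.map (proj₁ ∘ inPartSizes) p⊆partSizes
    ; bounded  = All.map (proj₂ ∘ inPartSizes) p⊆partSizes }
    where
    p⊆partSizes = proj₂ (tuples-sound (partSizes K) j p p∈tuplesʲ)
    inPartSizes : ∀ {x} → x ∈ partSizes K → 1 ≤ x × x ≤ K
    inPartSizes x∈ with ∈-map⁻ suc x∈
    ... | y , y∈ , refl = s≤s z≤n , ∈-upTo⁻ y∈

  partitions-complete : ∀ K p → IsPartition K K p → p ∈ partitions K
  partitions-complete K p part = ∈-filter⁺ (T? ∘ isPartitionᵇ K)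
    (∈-concatMap⁺ (tuples (partSizes K)) (lose (∈-upTo⁺ (s≤s length≤K)) (tuples-complete (partSizes K) p p⊆partSizes)))
    (Equivalence.from T-∧ (nonincr part , ≡⇒≡ᵇ _ _ (sums part)))
    where
    length≤K : length p ≤ K
    length≤K = subst (length p ≤_) (sums part) (length≤sumℕ p (positive part))
    p⊆partSizes : All (_∈ partSizes K) p
    p⊆partSizes = All.zipWith (λ (1≤x , x≤K) → ∈-partSizes 1≤x x≤K) (positive part , bounded part)

  partitions↭boundedPartitions : ∀ K → partitions K ↭ boundedPartitions K K
  partitions↭boundedPartitions K = ∼bag⇒↭ (unique∧set⇒bag (partitions-unique K) (boundedPartitions-unique K K)
    (λ {p} → mk⇔ (boundedPartitions-complete K K p ∘ partitions-sound K p)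
                 (partitions-complete K p ∘ boundedPartitions-sound K K p)))

  boundedPartitions-exact : ∀ K b → b ≤ K → ∀ k p → p ∈ boundedPartitions b k →
                            ∀ m → length p ≤ m → ExactMultinomial K m p
  boundedPartitions-exact K zero    _   zero p (here refl) m _ = proj₂ (multinomial-[] K m)
  boundedPartitions-exact K (suc b) b<K k p p∈ m l≤m with ∈-boundedPartitions-suc⁻ b k p∈
  ... | s , _ , q , refl , q∈ = proj₂ (multinomial-replicate-++ K m s (suc b) q (s≤s z≤n) b<K
          (All.map s≤s (bounded (boundedPartitions-sound b _ q q∈))) s+l≤m
          (boundedPartitions-exact K b (≤-trans (n≤1+n b) b<K) _ q q∈ (m ∸ s) l≤m∸s))
    where
    s+l≤m : s + length q ≤ m
    s+l≤m = subst (_≤ m) (length-replicate-++ s (suc b) q) l≤m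
    l≤m∸s : length q ≤ m ∸ s
    l≤m∸s = subst (_≤ m ∸ s) (m+n∸m≡n s (length q)) (∸-monoˡ-≤ s s+l≤m)

module MultinomialExpansion {c ℓ} (R : CommutativeRing c ℓ) where

  open CommutativeRing R hiding (zero; +-comm)
  open import Relation.Binary.Reasoning.Setoid setoid
  open import Algebra.Properties.Semiring.Exp semiring using (_^_)
  open import Algebra.Properties.Semiring.Mult semiring using (_×_; ×-congʳ; ×-assocˡ; ×-comm-*)
  open import Data.Unit using (tt)
  open import Data.Empty using (⊥-elim)
  open import Data.Bool using (T)
  open import Data.Nat.Properties using (_≤?_; ≤ᵇ⇒≤; ≰⇒>; <⇒≱; ≤-trans; n≤1+n; m≤m+n; m≤m*n; +-comm)
  open import Data.Nat.Combinatorics using (_C_; k>n⇒nCk≡0)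
  open import Data.List using (replicate; upTo)
  open import Data.List.Relation.Unary.All as All using ()
  open import Data.List.Membership.Propositional using (_∈_)
  open import Data.Product using (proj₁)
  open import Relation.Nullary using (yes; no)
  open ListSums R
  open FormalPowerSeries R using (PowerSeries; truncatedPower; binomialTermAt; truncatedPower-suc; truncatedPower-zero)
  open PartitionCounting
  open BoundedPartitions

  Πᴿ-map-replicate-++ : ∀ (f : ℕ → Carrier) s a q → Πᴿ R (map f (replicate s a ++ q)) ≈ f a ^ s * Πᴿ R (map f q)
  Πᴿ-map-replicate-++ f zero    a q = sym (*-identityˡ _)
  Πᴿ-map-replicate-++ f (suc s) a q = trans (*-congˡ (Πᴿ-map-replicate-++ f s a q)) (sym (*-assoc _ _ _))

  ≤ᵇ-+-∸ : ∀ s n m → s ≤ m → (s ℕ.+ n ≤ᵇ m) ≡ (n ≤ᵇ m ∸ s)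
  ≤ᵇ-+-∸ zero    n m       _         = ≡.refl
  ≤ᵇ-+-∸ (suc s) n (suc m) (s≤s s≤m) = ≡.trans (suc-≤ᵇ-suc (s ℕ.+ n) m) (≤ᵇ-+-∸ s n m s≤m)

  module _ (K : ℕ) (f : PowerSeries) where

    partitionTerm : ℕ → List ℕ → Carrier
    partitionTerm m = when (λ p → l p ≤ᵇ m) (λ p → multinomial K m p × Πᴿ R (map f p))

    partitionSum : ℕ → ℕ → ℕ → Carrier
    partitionSum m k b = sumOver (partitionTerm m) (boundedPartitions b k)

    partitionTerm-replicate-++ : ∀ b → suc b ≤ K → ∀ k s q → q ∈ boundedPartitions b k → ∀ m →
      partitionTerm m (replicate s (suc b) ++ q) ≈ (m C s) × (f (suc b) ^ s * partitionTerm (m ∸ s) q)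
    partitionTerm-replicate-++ b b<K k s q q∈ m with s ≤? m
    ... | no s≰m rewrite k>n⇒nCk≡0 (≰⇒> s≰m) = tooManyParts
      where
      tooManyParts : partitionTerm m (replicate s (suc b) ++ q) ≈ 0#
      tooManyParts with l (replicate s (suc b) ++ q) ≤ᵇ m in test
      ... | false = refl
      ... | true  = ⊥-elim (s≰m (≤-trans (m≤m+n s (length q))
                      (≡.subst (_≤ m) (length-replicate-++ s (suc b) q) (≤ᵇ⇒≤ _ _ (≡.subst T (≡.sym test) tt)))))
    ... | yes s≤m =
      trans (reflexive (≡.cong (λ β → if β then multinomial K m p × Πᴿ R (map f p) else 0#) lengthTest)) byTest
      where
      lengthTest : (l (replicate s (suc b) ++ q) ≤ᵇ m) ≡ (l q ≤ᵇ m ∸ s)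
      lengthTest = ≡.trans (≡.cong (_≤ᵇ m) (length-replicate-++ s (suc b) q)) (≤ᵇ-+-∸ s (length q) m s≤m)
      p = replicate s (suc b) ++ q
      byTest : (if l q ≤ᵇ m ∸ s then multinomial K m p × Πᴿ R (map f p) else 0#)
               ≈ (m C s) × (f (suc b) ^ s * partitionTerm (m ∸ s) q)
      byTest with l q ≤ᵇ m ∸ s in test
      ... | false = sym (trans (×-congʳ (m C s) (zeroʳ (f (suc b) ^ s))) (×-zeroʳ (m C s)))
      ... | true  = begin
        multinomial K m p × Πᴿ R (map f p)               ≡⟨ ≡.cong (_× Πᴿ R (map f p)) multinomial≡ ⟩
        ((m C s) ℕ.* μ) × Πᴿ R (map f p)                 ≈⟨ ×-assocˡ _ (m C s) μ ⟨
        (m C s) × (μ × Πᴿ R (map f p))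
          ≈⟨ ×-congʳ (m C s) (×-congʳ μ (Πᴿ-map-replicate-++ f s (suc b) q)) ⟩
        (m C s) × (μ × (f (suc b) ^ s * Πᴿ R (map f q))) ≈⟨ ×-congʳ (m C s) (×-comm-* μ _ _) ⟨
        (m C s) × (f (suc b) ^ s * (μ × Πᴿ R (map f q))) ∎
        where
        μ = multinomial K (m ∸ s) q
        l≤m∸s = ≤ᵇ⇒≤ _ _ (≡.subst T (≡.sym test) tt)
        multinomial≡ : multinomial K m p ≡ (m C s) ℕ.* μ
        multinomial≡ = proj₁ (multinomial-replicate-++ K m s (suc b) q (s≤s z≤n) b<K
          (All.map s≤s (IsPartition.bounded (boundedPartitions-sound b _ q q∈)))
          (≤ᵇ⇒≤ _ _ (≡.subst T (≡.sym (≡.trans (≤ᵇ-+-∸ s (length q) m s≤m) test)) tt))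
          (boundedPartitions-exact K b (≤-trans (n≤1+n b) b<K) _ q q∈ (m ∸ s) l≤m∸s))

    partitionSum-suc : ∀ b → suc b ≤ K → ∀ m k → partitionSum m k (suc b) ≈
      sumOver (λ s → (m C s) × (f (suc b) ^ s *
                       (if s ℕ.* suc b ≤ᵇ k then partitionSum (m ∸ s) (k ∸ s ℕ.* suc b) b else 0#)))
              (upTo (suc k))
    partitionSum-suc b b<K m k =
      trans (sumOver-concatMap (partitionTerm m) (largestPartBlock b k) (upTo (suc k))) (sumOver-cong blockSum (upTo (suc k)))
      where
      blockSum : ∀ s → sumOver (partitionTerm m) (largestPartBlock b k s) ≈
        (m C s) × (f (suc b) ^ s * (if s ℕ.* suc b ≤ᵇ k then partitionSum (m ∸ s) (k ∸ s ℕ.* suc b) b else 0#))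
      blockSum s with s ℕ.* suc b ≤ᵇ k
      ... | false = sym (trans (×-congʳ (m C s) (zeroʳ (f (suc b) ^ s))) (×-zeroʳ (m C s)))
      ... | true  = begin
        sumOver (partitionTerm m) (map (replicate s (suc b) ++_) (boundedPartitions b k′))
          ≡⟨ sumOver-map (partitionTerm m) (replicate s (suc b) ++_) (boundedPartitions b k′) ⟩
        sumOver (partitionTerm m ∘ (replicate s (suc b) ++_)) (boundedPartitions b k′)
          ≈⟨ sumOver-cong-All (All.tabulate (λ {q} q∈ → partitionTerm-replicate-++ b b<K k′ s q q∈ m)) ⟩
        sumOver (λ q → (m C s) × (f (suc b) ^ s * partitionTerm (m ∸ s) q)) (boundedPartitions b k′)
          ≈⟨ ×-distrib-sumOver (m C s) _ (boundedPartitions b k′) ⟨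
        (m C s) × sumOver (λ q → f (suc b) ^ s * partitionTerm (m ∸ s) q) (boundedPartitions b k′)
          ≈⟨ ×-congʳ (m C s) (*-distribˡ-sumOver _ (partitionTerm (m ∸ s)) (boundedPartitions b k′)) ⟨
        (m C s) × (f (suc b) ^ s * partitionSum (m ∸ s) k′ b) ∎
        where k′ = k ∸ s ℕ.* suc b

  -- Only the terms with s ≤ min(m, k) of the binomial expansion are nonzero.
  binomialTermAt-upTo : ∀ f m k b →
    sumOver (binomialTermAt f m k b) (upTo (suc k)) ≈ sumOver (binomialTermAt f m k b) (upTo (suc m))
  binomialTermAt-upTo f m k b = begin
    sumOver term (upTo (suc k))           ≈⟨ sumOver-applyUpTo-+ term id (suc k) (suc m) beyondK ⟨
    sumOver term (upTo (suc k ℕ.+ suc m)) ≡⟨ ≡.cong (λ n → sumOver term (upTo n)) (+-comm (suc k) (suc m)) ⟩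
    sumOver term (upTo (suc m ℕ.+ suc k)) ≈⟨ sumOver-applyUpTo-+ term id (suc m) (suc k) beyondM ⟩
    sumOver term (upTo (suc m))           ∎
    where
    term = binomialTermAt f m k b
    beyondM : ∀ s → suc m ≤ s → term s ≈ 0#
    beyondM s m<s rewrite k>n⇒nCk≡0 m<s = refl
    beyondK : ∀ s → suc k ≤ s → term s ≈ 0#
    beyondK s k<s with s ℕ.* suc b ≤ᵇ k in test
    ... | false = trans (×-congʳ (m C s) (zeroʳ _)) (×-zeroʳ (m C s))
    ... | true  = ⊥-elim (<⇒≱ k<s (≤-trans (m≤m*n s (suc b)) (≤ᵇ⇒≤ _ _ (≡.subst T (≡.sym test) tt))))

  partitionSum≈truncatedPower : ∀ K f → f 0 ≈ 1# → ∀ b → b ≤ K → ∀ m k →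
                                partitionSum K f m k b ≈ truncatedPower f m b k
  partitionSum≈truncatedPower K f f₀≈1 zero    _   m zero    = begin
    partitionSum K f m 0 0 ≡⟨ ≡.cong (λ μ → μ × 1# + 0#) (proj₁ (multinomial-[] K m)) ⟩
    (1# + 0#) + 0#         ≈⟨ trans (+-identityʳ _) (+-identityʳ _) ⟩
    1#                     ≈⟨ truncatedPower-zero f f₀≈1 m 0 ⟨
    truncatedPower f m 0 0 ∎
  partitionSum≈truncatedPower K f f₀≈1 zero    _   m (suc k) = sym (truncatedPower-zero f f₀≈1 m (suc k))
  partitionSum≈truncatedPower K f f₀≈1 (suc b) b<K m k       = begin
    partitionSum K f m k (suc b)
      ≈⟨ partitionSum-suc K f b b<K m k ⟩
    sumOver (λ s → (m C s) × (f (suc b) ^ s *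
                     (if s ℕ.* suc b ≤ᵇ k then partitionSum K f (m ∸ s) (k ∸ s ℕ.* suc b) b else 0#)))
            (upTo (suc k))
      ≈⟨ sumOver-cong (λ s → ×-congʳ (m C s) (*-congˡ (byInduction s))) (upTo (suc k)) ⟩
    sumOver (binomialTermAt f m k b) (upTo (suc k))
      ≈⟨ binomialTermAt-upTo f m k b ⟩
    sumOver (binomialTermAt f m k b) (upTo (suc m))
      ≈⟨ truncatedPower-suc f m k b ⟨
    truncatedPower f m (suc b) k ∎
    where
    byInduction : ∀ s → (if s ℕ.* suc b ≤ᵇ k then partitionSum K f (m ∸ s) (k ∸ s ℕ.* suc b) b else 0#)
                      ≈ (if s ℕ.* suc b ≤ᵇ k then truncatedPower f (m ∸ s) b (k ∸ s ℕ.* suc b) else 0#)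
    byInduction s with s ℕ.* suc b ≤ᵇ k
    ... | true  = partitionSum≈truncatedPower K f f₀≈1 b (≤-trans (n≤1+n b) b<K) (m ∸ s) (k ∸ s ℕ.* suc b)
    ... | false = refl

open import Level using (Level)
open import Defs using (_×_)

corollary1p1 : {c ℓ : Level} (R : CommutativeRing c ℓ) (f : SymFam)
    (k m n : ℕ) → 1 ≤ k → 1 ≤ m → 1 ≤ n → (x : Fin n → CommutativeRing.Carrier R) →
    CommutativeRing._≈_ R
      (fSym R f k (copies R m (tabulate x)))
      (Σᴿ R (map (λ p → _×_ R (multinomial k m p) (fPart R f p (tabulate x)))
                 (filterᵇ (λ p → l p ≤ᵇ m) (partitions k))))
corollary1p1 R f k m n _ _ _ x = begin
  fSym R f k (copies R m xs)
    ≈⟨ genFun-copies f m xs k ⟩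
  (F ^ₚ m) k
    ≈⟨ ^ₚ≈truncatedPower F m k ⟩
  truncatedPower F m k k
    ≈⟨ partitionSum≈truncatedPower k F (fSym-zero f xs) k ≤-refl m k ⟨
  sumOver (partitionTerm k F m) (boundedPartitions k k)
    ≈⟨ sumOver-↭ (partitionTerm k F m) (partitions↭boundedPartitions k) ⟨
  sumOver (partitionTerm k F m) (partitions k)
    ≈⟨ sumOver-filter _ (λ p → l p ≤ᵇ m) (partitions k) ⟨
  Σᴿ R (map (λ p → _×_ R (multinomial k m p) (fPart R f p xs)) (filterᵇ (λ p → l p ≤ᵇ m) (partitions k))) ∎
  where
  open CommutativeRing R
  open import Relation.Binary.Reasoning.Setoid setoid
  open ListSums R
  open FormalPowerSeries R
  open GeneratingFunctions R
  open BoundedPartitions using (boundedPartitions; partitions↭boundedPartitions)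
  open MultinomialExpansion R
  xs = tabulate x
  F  = genFun f xs
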